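{- Let $p>2$ be a prime and let $A\subset\mathbb{Z}_p$ with $|A|\geq5$. Define $A_1=A$ and, for integers $k\geq2$, $A_k=N_kA^k-N_kA^k$ where $N_k=\frac5{24}4^k-\frac13$. Then for every positive integer $k$ and every real $U$ with $0\leq U\leq|A|^k$, $$|A_k|\geq U-\frac54\frac{U^2}{p-1}.$$
   Context: $\mathbb{Z}_p$ is the field of residues modulo $p$. $A^k=\{a_1\cdots a_k:\ a_i\in A\}$, $NS=\{s_1+\dots+s_N:\ s_i\in S\}$, and $S-T=\{s-t:\ s\in S, t\in T\}$. Note $N_k$ is a positive integer for $k\geq2$ (e.g. $N_2=3$, $N_3=13$).
   Formalization: The number U ranges over the rationals between 0 and |A|^k instead of over the reals. -}

module Defs where

open import Data.Nat using (ℕ; zero; suc; _+_; _*_; _∸_; _^_; NonZero)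
open import Data.Nat.DivMod using (_mod_; _/_)
open import Data.Fin using (Fin; toℕ)
open import Data.Fin.Subset using (Subset; ⋃; ⁅_⁆)
open import Data.Fin.Subset.Properties using (_∈?_)
open import Data.List using (List; filter; concatMap; map)
import Data.List as L

module _ {p : ℕ} .{{_ : NonZero p}} where

  _+ₚ_ : Fin p → Fin p → Fin p
  a +ₚ b = (toℕ a + toℕ b) mod p

  _*ₚ_ : Fin p → Fin p → Fin p
  a *ₚ b = (toℕ a * toℕ b) mod p

  _-ₚ_ : Fin p → Fin p → Fin p
  a -ₚ b = (toℕ a + (p ∸ toℕ b)) mod p

elems : {n : ℕ} → Subset n → List (Fin n)
elems {n} S = filter (λ x → x ∈? S) (L.allFin n)

image₂ : {n : ℕ} → (Fin n → Fin n → Fin n) → Subset n → Subset n → Subset n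
image₂ op S T = ⋃ (concatMap (λ s → map (λ t → ⁅ op s t ⁆) (elems T)) (elems S))

module _ {p : ℕ} .{{_ : NonZero p}} where

  _⊕_ : Subset p → Subset p → Subset p
  _⊕_ = image₂ _+ₚ_

  _⊖_ : Subset p → Subset p → Subset p
  _⊖_ = image₂ _-ₚ_

  _⊗_ : Subset p → Subset p → Subset p
  _⊗_ = image₂ _*ₚ_

  -- A^(suc m) = {a_1 ⋯ a_(m+1) : a_i ∈ A}
  prodPow : Subset p → ℕ → Subset p
  prodPow A zero    = A
  prodPow A (suc m) = prodPow A m ⊗ A

  -- (suc m) S = {s_1 + ⋯ + s_(m+1) : s_i ∈ S}
  sumMul : ℕ → Subset p → Subset p
  sumMul zero    S = S
  sumMul (suc m) S = sumMul m S ⊕ S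

-- N_k = (5/24) 4^k - 1/3 = (5 · 4^k - 8) / 24  (an exact positive integer for k ≥ 2)
N : ℕ → ℕ
N k = (5 * 4 ^ k ∸ 8) / 24

module _ {p : ℕ} .{{_ : NonZero p}} where

  -- A^k for k ≥ 1 (value at k = 0 is irrelevant; set to A)
  pow : Subset p → ℕ → Subset p
  pow A zero    = A
  pow A (suc m) = prodPow A m

  -- N S for N ≥ 1 (value at 0 irrelevant)
  mulSet : ℕ → Subset p → Subset p
  mulSet zero    S = S
  mulSet (suc m) S = sumMul m S

  -- A_1 = A, A_k = N_k A^k - N_k A^k for k ≥ 2  (A_0 unused; set to A)
  Aₖ : Subset p → ℕ → Subset p
  Aₖ A zero          = A
  Aₖ A (suc zero)    = A
  Aₖ A k@(suc (suc _)) = mulSet (N k) (pow A k) ⊖ mulSet (N k) (pow A k)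

{-# OPTIONS --safe #-}
-- Let q = p − 1. Suppose Z ⊆ ℤ_p contains all combinations (y₁ − y₂)x + (x₁ − x₂ + c(y₁ − y₂))y
-- with x, x₁, x₂ ∈ X and y, y₁, y₂ ∈ Y, where c ≠ 0, X ≠ ∅ and |Y| ≥ 2. Then p(w − |Z|) ≤ C(w, 2)
-- for every w ≤ |X||Y|. Indeed, let R be the set of ratios (x₁ − x₂)/(y₁ − y₂) and
-- φ_ζ(x, y) = x + ζy. If some ζ ∈ R has ζ + c ∉ R, then φ_{ζ+c} is injective on X × Y. Otherwise R,
-- which contains 0, is all of ℤ_p; as two points of X × Y collide under φ_ζ for at most one ζ, on
-- any w points some φ_ζ has at most C(w, 2)/p collisions. In both cases ζ − c ∈ R, that is
-- ζ(y₁ − y₂) = x₁ − x₂ + c(y₁ − y₂) for suitable xᵢ, yᵢ, so (y₁ − y₂)φ_ζ maps X × Y into Z.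
--
-- Since N₂ = 3 and N_{k+1} = 4N_k + 1, the set A_{k+1} contains these combinations for X = A_k,
-- Y = A and c = a^{k−1} with a ∈ A nonzero. Hence |A_{k+1}| ≥ w − w(w − 1)/(2q) for w ≤ |A_k||A|,
-- and 4qU − 5U² ≤ 4q|A_k| for 0 ≤ U ≤ |A|^k follows by induction on k: it is trivial for U > q;
-- for U ≤ |A_k||A| take w = ⌈U⌉; otherwise take w = |A_k||A| and apply the induction hypothesis
-- to U/|A|, which is where |A| ≥ 5 is needed.
module Submission where

open import Defs
open import Data.Nat as ℕ using (ℕ; zero; suc; NonZero; _∸_; _^_; z≤n; s≤s)
import Data.Nat.Properties as ℕP
open import Data.Nat.DivMod using (_mod_; _%_; m≡m%n+[m/n]*n; m%n<n; m*n/n≡m)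
import Data.Nat.Divisibility as ℕ∣
open import Data.Nat.Primality using (Prime; euclidsLemma; ¬prime[1])
open import Data.Nat.Coprimality using (coprime-Bézout; prime⇒coprime)
open import Data.Nat.GCD using (module Bézout)
open import Data.Nat.GeneralisedArithmetic using (fold)
open import Data.Integer as ℤ using (ℤ; +_)
import Data.Integer.Properties as ℤP
import Data.Integer.Divisibility.Signed as ℤ∣
open ℤ∣ using (divides; ∣m∣n⇒∣m+n; ∣m⇒∣-m; ∣n⇒∣m*n; ∣m⇒∣m*n; ∣⇒∣ᵤ; ∣ᵤ⇒∣)
open import Data.Integer.Tactic.RingSolver using (solve-∀)
open import Data.Nat.Tactic.RingSolver using () renaming (solve-∀ to ℕsolve-∀)
open import Data.Fin as Fin using (Fin; toℕ)
import Data.Fin.Properties as FinP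
open import Data.Fin.Subset as Subset using (Subset; ⋃; ⁅_⁆; ∣_∣; _∈_; inside; outside)
open import Data.Fin.Subset.Properties
  using (_∈?_; ∉⊥; x∈p∧x≢y⇒x∈p-y; x∈p⇒∣p-x∣<∣p∣; x∈p∪q⁻; p⊆p∪q; q⊆p∪q; x∈⁅x⁆; x∈⁅y⁆⇒x≡y)
open import Data.List as List using (List; []; _∷_; length; map; allFin; take; cartesianProduct)
import Data.List.Properties as ListP
open import Data.List.Membership.Propositional using (find; lose) renaming (_∈_ to _∈ₗ_)
open import Data.List.Membership.Propositional.Properties using (∈-filter⁺; ∈-filter⁻; ∈-allFin; ∈-map⁻)
open import Data.List.Relation.Unary.Any using (Any; here; there; any?)
import Data.List.Relation.Unary.Any.Properties as AnyP
open import Data.List.Relation.Unary.All as All using (All; []; _∷_)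
import Data.List.Relation.Unary.All.Properties as AllP
open import Data.List.Relation.Unary.AllPairs using ([]; _∷_)
open import Data.List.Relation.Unary.Unique.Propositional using (Unique)
import Data.List.Relation.Unary.Unique.Propositional.Properties as UniqueP
import Data.Vec as Vec
open import Function using (_∘_; id)
open import Relation.Unary using (_⟨×⟩_)
open import Data.Sum using (_⊎_; inj₁; inj₂; [_,_]′)
open import Data.Product using (_,_; _×_; ∃-syntax; proj₁; proj₂)
open import Relation.Binary.Bundles using (Setoid)
open import Relation.Binary.PropositionalEquality hiding ([_])
open import Relation.Nullary using (¬_; Dec; yes; no)
open import Data.Nat.ListAction using (sum)
open import Data.Nat.Combinatorics using (_C_; nC1≡n; nCk+nC[k+1]≡[n+1]C[k+1])
open import Data.Empty using (⊥-elim)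
open import Relation.Nullary.Decidable using (_×-dec_; ¬?)

module Congruence (p : ℕ) where

  open import Data.Integer using (_+_; _-_; _*_; -_)

  infix 4 _≈_ _≉_

  -- A record, so that x and y can be inferred from a proof of x ≈ y.
  record _≈_ (x y : ℤ) : Set where
    constructor ≈-by
    field p∣x-y : + p ℤ∣.∣ x - y

  _≉_ : ℤ → ℤ → Set
  x ≉ y = ¬ x ≈ y

  ≈-byDiff : ∀ {x y e} → x - y ≡ e → + p ℤ∣.∣ e → x ≈ y
  ≈-byDiff refl = ≈-by

  ≈-reflexive : ∀ {x y} → x ≡ y → x ≈ y
  ≈-reflexive {x} refl = ≈-byDiff (ℤP.+-inverseʳ x) (divides (+ 0) refl)

  ≈-sym : ∀ {x y} → x ≈ y → y ≈ x
  ≈-sym {x} {y} (≈-by d) = ≈-byDiff (lemma x y) (∣m⇒∣-m d)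
    where
      lemma : ∀ x y → y - x ≡ - (x - y)
      lemma = solve-∀

  ≈-trans : ∀ {x y z} → x ≈ y → y ≈ z → x ≈ z
  ≈-trans {x} {y} {z} (≈-by d) (≈-by e) = ≈-byDiff (lemma x y z) (∣m∣n⇒∣m+n d e)
    where
      lemma : ∀ x y z → x - z ≡ (x - y) + (y - z)
      lemma = solve-∀

  ≈-refl : ∀ {x} → x ≈ x
  ≈-refl = ≈-reflexive refl

  ≈-setoid : Setoid _ _
  ≈-setoid = record
    { Carrier = ℤ
    ; _≈_ = _≈_
    ; isEquivalence = record { refl = ≈-refl ; sym = ≈-sym ; trans = ≈-trans } }

  +-cong : ∀ {x y u v} → x ≈ y → u ≈ v → x + u ≈ y + v
  +-cong {x} {y} {u} {v} (≈-by d) (≈-by e) = ≈-byDiff (lemma x y u v) (∣m∣n⇒∣m+n d e)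
    where
      lemma : ∀ x y u v → (x + u) - (y + v) ≡ (x - y) + (u - v)
      lemma = solve-∀

  -‿cong : ∀ {x y} → x ≈ y → - x ≈ - y
  -‿cong {x} {y} (≈-by d) = ≈-byDiff (lemma x y) (∣m⇒∣-m d)
    where
      lemma : ∀ x y → - x - - y ≡ - (x - y)
      lemma = solve-∀

  -cong : ∀ {x y u v} → x ≈ y → u ≈ v → x - u ≈ y - v
  -cong e f = +-cong e (-‿cong f)

  -≈0⇒≈ : ∀ {x y} → x - y ≈ + 0 → x ≈ y
  -≈0⇒≈ {x} {y} (≈-by d) = ≈-byDiff (sym (ℤP.+-identityʳ (x - y))) d

  ≈-transport : ∀ {x y u v} → x ≈ y → u - v ≡ x - y → u ≈ v
  ≈-transport (≈-by d) eq = ≈-byDiff eq d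

  *-cong : ∀ {x y u v} → x ≈ y → u ≈ v → x * u ≈ y * v
  *-cong {x} {y} {u} {v} (≈-by d) (≈-by e) =
    ≈-byDiff (lemma x y u v) (∣m∣n⇒∣m+n (∣n⇒∣m*n x e) (∣m⇒∣m*n v d))
    where
      lemma : ∀ x y u v → x * u - y * v ≡ x * (u - v) + (x - y) * v
      lemma = solve-∀

module Residues (p : ℕ) .{{_ : NonZero p}} where

  open import Data.Integer using (_+_; _-_; _*_; -_)
  open Congruence p public

  ⟦_⟧ : Fin p → ℤ
  ⟦ a ⟧ = + toℕ a

  ⟦mod⟧ : ∀ n → ⟦ n mod p ⟧ ≈ + n
  ⟦mod⟧ n = ≈-byDiff difference (divides (- quotient) refl)
    where
      open ≡-Reasoning
      remainder quotient : ℤ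
      remainder = + (n % p)
      quotient  = + (n ℕ./ p)
      lemma : ∀ r q p → r - (r + q * p) ≡ - q * p
      lemma = solve-∀
      difference : ⟦ n mod p ⟧ - + n ≡ - quotient * + p
      difference = begin
        ⟦ n mod p ⟧ - + n                   ≡⟨ cong (_- + n) (cong +_ (FinP.toℕ-fromℕ< (m%n<n n p))) ⟩
        remainder - + n                     ≡⟨ cong (λ m → remainder - + m) (m≡m%n+[m/n]*n n p) ⟩
        remainder - + (n % p ℕ.+ n ℕ./ p ℕ.* p)   ≡⟨ cong (λ m → remainder - m) (ℤP.pos-+ (n % p) (n ℕ./ p ℕ.* p)) ⟩
        remainder - (remainder + + (n ℕ./ p ℕ.* p)) ≡⟨ cong (λ m → remainder - (remainder + m)) (ℤP.pos-* (n ℕ./ p) p) ⟩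
        remainder - (remainder + quotient * + p) ≡⟨ lemma remainder quotient (+ p) ⟩
        - quotient * + p                    ∎

  ⟦+ₚ⟧ : ∀ a b → ⟦ a +ₚ b ⟧ ≈ ⟦ a ⟧ + ⟦ b ⟧
  ⟦+ₚ⟧ a b = ⟦mod⟧ (toℕ a ℕ.+ toℕ b)

  ⟦*ₚ⟧ : ∀ a b → ⟦ a *ₚ b ⟧ ≈ ⟦ a ⟧ * ⟦ b ⟧
  ⟦*ₚ⟧ a b = ≈-trans (⟦mod⟧ (toℕ a ℕ.* toℕ b)) (≈-reflexive (ℤP.pos-* (toℕ a) (toℕ b)))

  ⟦-ₚ⟧ : ∀ a b → ⟦ a -ₚ b ⟧ ≈ ⟦ a ⟧ - ⟦ b ⟧
  ⟦-ₚ⟧ a b = ≈-trans (⟦mod⟧ (toℕ a ℕ.+ (p ∸ toℕ b))) (≈-byDiff difference (divides (+ 1) (sym (ℤP.*-identityˡ (+ p)))))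
    where
      lemma : ∀ a b p → (a + (p - b)) - (a - b) ≡ p
      lemma = solve-∀
      p-b : + (p ∸ toℕ b) ≡ + p - ⟦ b ⟧
      p-b = trans (sym (ℤP.⊖-≥ (ℕP.<⇒≤ (FinP.toℕ<n b)))) (sym (ℤP.m-n≡m⊖n p (toℕ b)))
      difference : + (toℕ a ℕ.+ (p ∸ toℕ b)) - (⟦ a ⟧ - ⟦ b ⟧) ≡ + p
      difference = trans (cong (λ m → (⟦ a ⟧ + m) - (⟦ a ⟧ - ⟦ b ⟧)) p-b) (lemma ⟦ a ⟧ ⟦ b ⟧ (+ p))

  ⟦⟧-injective : ∀ {a b} → ⟦ a ⟧ ≈ ⟦ b ⟧ → a ≡ b
  ⟦⟧-injective {a} {b} a≈b =
    [ (λ b≤a → ordered b≤a a≈b) , (λ a≤b → sym (ordered a≤b (≈-sym a≈b))) ]′ (ℕP.≤-total (toℕ b) (toℕ a))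
    where
      small-multiple : ∀ {m} → m ℕ.< p → p ℕ∣.∣ m → m ≡ 0
      small-multiple {zero}  _   _   = refl
      small-multiple {suc m} m<p p∣m = ⊥-elim (ℕ∣.>⇒∤ m<p p∣m)

      ordered : ∀ {a b} → toℕ b ℕ.≤ toℕ a → ⟦ a ⟧ ≈ ⟦ b ⟧ → a ≡ b
      ordered {a} {b} b≤a (≈-by d) = FinP.toℕ-injective (ℕP.≤-antisym (ℕP.m∸n≡0⇒m≤n a∸b≡0) b≤a)
        where
          p∣a∸b : p ℕ∣.∣ toℕ a ∸ toℕ b
          p∣a∸b = subst (λ e → p ℕ∣.∣ ℤ.∣ e ∣) (trans (ℤP.m-n≡m⊖n (toℕ a) (toℕ b)) (ℤP.⊖-≥ b≤a)) (∣⇒∣ᵤ d)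
          a∸b≡0 : toℕ a ∸ toℕ b ≡ 0
          a∸b≡0 = small-multiple (ℕP.≤-<-trans (ℕP.m∸n≤m (toℕ a) (toℕ b)) (FinP.toℕ<n a)) p∣a∸b

  ≢0⇒≉0 : ∀ {a} → a ≢ 0 mod p → ⟦ a ⟧ ≉ + 0
  ≢0⇒≉0 a≢0 a≈0 = a≢0 (⟦⟧-injective (≈-trans a≈0 (≈-sym (⟦mod⟧ 0))))

  ≢⇒-≉0 : ∀ {a b} → a ≢ b → ⟦ a ⟧ - ⟦ b ⟧ ≉ + 0
  ≢⇒-≉0 a≢b a-b≈0 = a≢b (⟦⟧-injective (-≈0⇒≈ a-b≈0))

  module Field (prime : Prime p) where

    p∣*⇒p∣⊎p∣ : ∀ x y → + p ℤ∣.∣ x * y → + p ℤ∣.∣ x ⊎ + p ℤ∣.∣ y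
    p∣*⇒p∣⊎p∣ x y d with euclidsLemma ℤ.∣ x ∣ ℤ.∣ y ∣ prime (subst (p ℕ∣.∣_) (ℤP.abs-* x y) (∣⇒∣ᵤ d))
    ... | inj₁ p∣x = inj₁ (∣ᵤ⇒∣ p∣x)
    ... | inj₂ p∣y = inj₂ (∣ᵤ⇒∣ p∣y)

    ≈0-by : ∀ {x} → + p ℤ∣.∣ x → x ≈ + 0
    ≈0-by {x} = ≈-byDiff (ℤP.+-identityʳ x)

    *-cancelˡ-≈ : ∀ t {x y} → t ≉ + 0 → t * x ≈ t * y → x ≈ y
    *-cancelˡ-≈ t {x} {y} t≉0 (≈-by d) with p∣*⇒p∣⊎p∣ t (x - y) (subst (+ p ℤ∣.∣_) (lemma t x y) d)
      where
        lemma : ∀ t x y → t * x - t * y ≡ t * (x - y)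
        lemma = solve-∀
    ... | inj₁ p∣t = ⊥-elim (t≉0 (≈0-by p∣t))
    ... | inj₂ p∣x-y = ≈-by p∣x-y

    *-≉0 : ∀ {x y} → x ≉ + 0 → y ≉ + 0 → x * y ≉ + 0
    *-≉0 {x} {y} x≉0 y≉0 (≈-by d) with p∣*⇒p∣⊎p∣ x y (subst (+ p ℤ∣.∣_) (ℤP.+-identityʳ (x * y)) d)
    ... | inj₁ p∣x = x≉0 (≈0-by p∣x)
    ... | inj₂ p∣y = y≉0 (≈0-by p∣y)

    1≉0 : + 1 ≉ + 0
    1≉0 (≈-by d) = ¬prime[1] (subst Prime (ℕ∣.∣1⇒≡1 (∣⇒∣ᵤ d)) prime)

    private
      Bézout-in-ℤ : ∀ a b c d → 1 ℕ.+ a ℕ.* b ≡ c ℕ.* d → + 1 + + a * + b ≡ + c * + d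
      Bézout-in-ℤ a b c d eq = begin
        + 1 + + a * + b       ≡⟨ cong (λ m → + 1 + m) (ℤP.pos-* a b) ⟨
        + (1 ℕ.+ a ℕ.* b)     ≡⟨ cong +_ eq ⟩
        + (c ℕ.* d)           ≡⟨ ℤP.pos-* c d ⟩
        + c * + d             ∎
        where open ≡-Reasoning

    ⟦⟧-invertible : ∀ c → ⟦ c ⟧ ≉ + 0 → ∃[ m ] + m * ⟦ c ⟧ ≈ + 1
    ⟦⟧-invertible c c≉0 with coprime-Bézout (prime⇒coprime prime {{nonZero}} (FinP.toℕ<n c))
      where
        nonZero : NonZero (toℕ c)
        nonZero = ℕ.≢-nonZero (λ c≡0 → c≉0 (≈-reflexive (cong +_ c≡0)))
    ... | Bézout.-+ x y eq = y , ≈-byDiff difference (divides (+ x) refl)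
      where
        lemma : ∀ x p → (+ 1 + x * p) - + 1 ≡ x * p
        lemma = solve-∀
        difference : + y * ⟦ c ⟧ - + 1 ≡ + x * + p
        difference = trans (cong (_- + 1) (sym (Bézout-in-ℤ x p y (toℕ c) eq))) (lemma (+ x) (+ p))
    -- Here y c ≈ -1, so (y y c) c = (y c)² ≈ 1.
    ... | Bézout.+- x y eq = y ℕ.* y ℕ.* toℕ c , ≈-byDiff difference (divides (+ x * (yc - + 1)) refl)
      where
        yc : ℤ
        yc = + y * ⟦ c ⟧
        lemma : ∀ y c → (y * y * c) * c - + 1 ≡ (+ 1 + y * c) * (y * c - + 1)
        lemma = solve-∀
        lemma′ : ∀ x p u → x * p * u ≡ x * u * p
        lemma′ = solve-∀
        difference : + (y ℕ.* y ℕ.* toℕ c) * ⟦ c ⟧ - + 1 ≡ + x * (yc - + 1) * + p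
        difference = begin
          + (y ℕ.* y ℕ.* toℕ c) * ⟦ c ⟧ - + 1 ≡⟨ cong (λ m → m * ⟦ c ⟧ - + 1)
                                                     (trans (ℤP.pos-* (y ℕ.* y) (toℕ c)) (cong (_* ⟦ c ⟧) (ℤP.pos-* y y))) ⟩
          + y * + y * ⟦ c ⟧ * ⟦ c ⟧ - + 1      ≡⟨ lemma (+ y) ⟦ c ⟧ ⟩
          (+ 1 + yc) * (yc - + 1)               ≡⟨ cong (_* (yc - + 1)) (Bézout-in-ℤ y (toℕ c) x p eq) ⟩
          + x * + p * (yc - + 1)                ≡⟨ lemma′ (+ x) (+ p) (yc - + 1) ⟩
          + x * (yc - + 1) * + p                ∎
          where open ≡-Reasoning

    +ₚ-induction : ∀ (P : Fin p → Set) c → ⟦ c ⟧ ≉ + 0 → ∀ {ζ₀} → P ζ₀ →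
                   (∀ {ζ} → P ζ → P (ζ +ₚ c)) → ∀ ζ → P ζ
    +ₚ-induction P c c≉0 {ζ₀} P₀ step ζ = subst P reaches (P-fold j)
      where
        open import Relation.Binary.Reasoning.Setoid ≈-setoid
        m j : ℕ
        m = proj₁ (⟦⟧-invertible c c≉0)
        j = toℕ (ζ -ₚ ζ₀) ℕ.* m

        P-fold : ∀ j → P (fold ζ₀ (_+ₚ c) j)
        P-fold zero    = P₀
        P-fold (suc j) = step (P-fold j)

        ⟦fold⟧ : ∀ j → ⟦ fold ζ₀ (_+ₚ c) j ⟧ ≈ ⟦ ζ₀ ⟧ + + j * ⟦ c ⟧
        ⟦fold⟧ zero    = ≈-reflexive (sym (ℤP.+-identityʳ ⟦ ζ₀ ⟧))
        ⟦fold⟧ (suc j) =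
          ≈-trans (⟦+ₚ⟧ _ c) (≈-trans (+-cong (⟦fold⟧ j) ≈-refl) (≈-reflexive (lemma ⟦ ζ₀ ⟧ (+ j) ⟦ c ⟧)))
          where
            lemma : ∀ z j c → (z + j * c) + c ≡ z + (+ 1 + j) * c
            lemma = solve-∀

        jc≈ζ-ζ₀ : + j * ⟦ c ⟧ ≈ ⟦ ζ ⟧ - ⟦ ζ₀ ⟧
        jc≈ζ-ζ₀ = begin
          + j * ⟦ c ⟧                  ≡⟨ cong (_* ⟦ c ⟧) (ℤP.pos-* (toℕ (ζ -ₚ ζ₀)) m) ⟩
          ⟦ ζ -ₚ ζ₀ ⟧ * + m * ⟦ c ⟧    ≡⟨ ℤP.*-assoc ⟦ ζ -ₚ ζ₀ ⟧ (+ m) ⟦ c ⟧ ⟩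
          ⟦ ζ -ₚ ζ₀ ⟧ * (+ m * ⟦ c ⟧)  ≈⟨ *-cong (⟦-ₚ⟧ ζ ζ₀) (proj₂ (⟦⟧-invertible c c≉0)) ⟩
          (⟦ ζ ⟧ - ⟦ ζ₀ ⟧) * + 1       ≡⟨ ℤP.*-identityʳ (⟦ ζ ⟧ - ⟦ ζ₀ ⟧) ⟩
          ⟦ ζ ⟧ - ⟦ ζ₀ ⟧               ∎

        reaches : fold ζ₀ (_+ₚ c) j ≡ ζ
        reaches = ⟦⟧-injective (begin
          ⟦ fold ζ₀ (_+ₚ c) j ⟧      ≈⟨ ⟦fold⟧ j ⟩
          ⟦ ζ₀ ⟧ + + j * ⟦ c ⟧       ≈⟨ +-cong (≈-refl {⟦ ζ₀ ⟧}) jc≈ζ-ζ₀ ⟩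
          ⟦ ζ₀ ⟧ + (⟦ ζ ⟧ - ⟦ ζ₀ ⟧)  ≡⟨ lemma ⟦ ζ₀ ⟧ ⟦ ζ ⟧ ⟩
          ⟦ ζ ⟧                      ∎)
          where
            lemma : ∀ z₀ z → z₀ + (z - z₀) ≡ z
            lemma = solve-∀

module _ {n : ℕ} where

  ∈⋃⁺ : ∀ {x : Fin n} {Us} → Any (x ∈_) Us → x ∈ ⋃ Us
  ∈⋃⁺ {Us = U ∷ Us} (here x∈U)  = p⊆p∪q (⋃ Us) x∈U
  ∈⋃⁺ {Us = U ∷ Us} (there x∈⋃) = q⊆p∪q U (⋃ Us) (∈⋃⁺ x∈⋃)

  ∈⋃⁻ : ∀ {x : Fin n} Us → x ∈ ⋃ Us → Any (x ∈_) Us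
  ∈⋃⁻ []       x∈⊥ = ⊥-elim (∉⊥ x∈⊥)
  ∈⋃⁻ (U ∷ Us) x∈  = [ here , there ∘ ∈⋃⁻ Us ]′ (x∈p∪q⁻ U (⋃ Us) x∈)

  ∈-elems⁺ : ∀ {x : Fin n} {S} → x ∈ S → x ∈ₗ elems S
  ∈-elems⁺ {x} {S} x∈S = ∈-filter⁺ (_∈? S) (∈-allFin x) x∈S

  ∈-elems⁻ : ∀ {x : Fin n} {S} → x ∈ₗ elems S → x ∈ S
  ∈-elems⁻ {S = S} x∈ = proj₂ (∈-filter⁻ (_∈? S) {xs = allFin n} x∈)

  module _ (_∙_ : Fin n → Fin n → Fin n) {S T : Subset n} where

    private
      singletons : Fin n → List (Subset n)
      singletons s = map (λ t → ⁅ s ∙ t ⁆) (elems T)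

    ∈-image₂⁺ : ∀ {s t} → s ∈ S → t ∈ T → s ∙ t ∈ image₂ _∙_ S T
    ∈-image₂⁺ s∈S t∈T =
      ∈⋃⁺ (AnyP.concatMap⁺ singletons (lose (∈-elems⁺ s∈S) (AnyP.map⁺ (lose (∈-elems⁺ t∈T) (x∈⁅x⁆ _)))))

    ∈-image₂⁻ : ∀ {z} → z ∈ image₂ _∙_ S T → ∃[ s ] ∃[ t ] s ∈ S × t ∈ T × z ≡ s ∙ t
    ∈-image₂⁻ z∈ with find (AnyP.concatMap⁻ singletons {xs = elems S} (∈⋃⁻ _ z∈))
    ... | s , s∈ , z∈′ with find (AnyP.map⁻ z∈′)
    ... | t , t∈ , z∈⁅s∙t⁆ = s , t , ∈-elems⁻ s∈ , ∈-elems⁻ t∈ , x∈⁅y⁆⇒x≡y _ z∈⁅s∙t⁆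

module _ {A B : Set} where

  length-cartesianProduct : ∀ (xs : List A) (ys : List B) →
                            length (cartesianProduct xs ys) ≡ length xs ℕ.* length ys
  length-cartesianProduct []       ys = refl
  length-cartesianProduct (x ∷ xs) ys = begin
    length (map (x ,_) ys List.++ cartesianProduct xs ys)    ≡⟨ ListP.length-++ (map (x ,_) ys) ⟩
    length (map (x ,_) ys) ℕ.+ length (cartesianProduct xs ys) ≡⟨ cong₂ ℕ._+_ (ListP.length-map (x ,_) ys) (length-cartesianProduct xs ys) ⟩
    length ys ℕ.+ length xs ℕ.* length ys                    ∎
    where open ≡-Reasoning

  All-cartesianProduct⁺ : ∀ {P : A → Set} {Q : B → Set} {xs ys} →
                          All P xs → All Q ys → All (P ⟨×⟩ Q) (cartesianProduct xs ys)
  All-cartesianProduct⁺ []         Qys = []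
  All-cartesianProduct⁺ (Px ∷ Pxs) Qys =
    AllP.++⁺ (AllP.map⁺ (All.map (Px ,_) Qys)) (All-cartesianProduct⁺ Pxs Qys)

toList : ∀ {n} → Subset n → List (Fin n)
toList Vec.[]            = []
toList (inside Vec.∷ S)  = Fin.zero ∷ map Fin.suc (toList S)
toList (outside Vec.∷ S) = map Fin.suc (toList S)

length-toList : ∀ {n} (S : Subset n) → length (toList S) ≡ ∣ S ∣
length-toList Vec.[]            = refl
length-toList (inside Vec.∷ S)  = cong suc (trans (ListP.length-map Fin.suc (toList S)) (length-toList S))
length-toList (outside Vec.∷ S) = trans (ListP.length-map Fin.suc (toList S)) (length-toList S)

toList-∈ : ∀ {n} (S : Subset n) → All (_∈ S) (toList S)
toList-∈ Vec.[]            = []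
toList-∈ (inside Vec.∷ S)  = Vec.here ∷ AllP.map⁺ (All.map Vec.there (toList-∈ S))
toList-∈ (outside Vec.∷ S) = AllP.map⁺ (All.map Vec.there (toList-∈ S))

toList-unique : ∀ {n} (S : Subset n) → Unique (toList S)
toList-unique Vec.[]            = []
toList-unique (inside Vec.∷ S)  = All.tabulate zero∉ ∷ UniqueP.map⁺ FinP.suc-injective (toList-unique S)
  where
    zero∉ : ∀ {x} → x ∈ₗ map Fin.suc (toList S) → Fin.zero ≢ x
    zero∉ x∈ refl with ∈-map⁻ Fin.suc x∈
    ... | _ , _ , ()
toList-unique (outside Vec.∷ S) = UniqueP.map⁺ FinP.suc-injective (toList-unique S)

two-distinct : ∀ {n} (S : Subset n) → 2 ℕ.≤ ∣ S ∣ → ∃[ x ] ∃[ y ] x ∈ S × y ∈ S × x ≢ y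
two-distinct S 2≤∣S∣ with toList S | length-toList S | toList-∈ S | toList-unique S
... | []        | 0≡∣S∣ | _             | _             = ⊥-elim (ℕP.<⇒≱ 2≤∣S∣ (subst (ℕ._≤ 1) 0≡∣S∣ z≤n))
... | _ ∷ []    | 1≡∣S∣ | _             | _             = ⊥-elim (ℕP.<⇒≱ 2≤∣S∣ (subst (ℕ._≤ 1) 1≡∣S∣ ℕP.≤-refl))
... | x ∷ y ∷ _ | _     | x∈S ∷ y∈S ∷ _ | (x≢y ∷ _) ∷ _ = x , y , x∈S , y∈S , x≢y

_×ₛ_ : ∀ {n} → Subset n → Subset n → Fin n × Fin n → Set
X ×ₛ Y = (_∈ X) ⟨×⟩ (_∈ Y)

distinct-pairs : ∀ {n} (X Y : Subset n) {w} → w ℕ.≤ ∣ X ∣ ℕ.* ∣ Y ∣ →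
                 ∃[ D ] length D ≡ w × Unique D × All (X ×ₛ Y) D
distinct-pairs {n} X Y {w} w≤ = take w XY , length-take , UniqueP.take⁺ w unique , AllP.take⁺ w members
  where
    XY : List (Fin n × Fin n)
    XY = cartesianProduct (toList X) (toList Y)
    length-XY : length XY ≡ ∣ X ∣ ℕ.* ∣ Y ∣
    length-XY = trans (length-cartesianProduct (toList X) (toList Y)) (cong₂ ℕ._*_ (length-toList X) (length-toList Y))
    length-take : length (take w XY) ≡ w
    length-take = trans (ListP.length-take w XY) (ℕP.m≤n⇒m⊓n≡m (subst (w ℕ.≤_) (sym length-XY) w≤))
    unique : Unique XY
    unique = UniqueP.cartesianProduct⁺ (toList-unique X) (toList-unique Y)
    members : All (X ×ₛ Y) XY
    members = All-cartesianProduct⁺ (toList-∈ X) (toList-∈ Y)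

𝟙 : ∀ {P : Set} → Dec P → ℕ
𝟙 (yes _) = 1
𝟙 (no _)  = 0

module _ {A : Set} where

  count : ∀ {P : A → Set} → (∀ x → Dec (P x)) → List A → ℕ
  count P? xs = sum (map (𝟙 ∘ P?) xs)

  sum-map-+ : ∀ (f g : A → ℕ) xs → sum (map (λ x → f x ℕ.+ g x) xs) ≡ sum (map f xs) ℕ.+ sum (map g xs)
  sum-map-+ f g []       = refl
  sum-map-+ f g (x ∷ xs) = trans (cong (f x ℕ.+ g x ℕ.+_) (sum-map-+ f g xs)) (swap (f x) (g x) _ _)
    where
      swap : ∀ a b c d → a ℕ.+ b ℕ.+ (c ℕ.+ d) ≡ a ℕ.+ c ℕ.+ (b ℕ.+ d)
      swap = ℕsolve-∀

  sum-map-0 : ∀ xs → sum (map (λ (_ : A) → 0) xs) ≡ 0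
  sum-map-0 []       = refl
  sum-map-0 (_ ∷ xs) = sum-map-0 xs

  min≤average : ∀ (f : A → ℕ) (default : A) xs → ∃[ y ] length xs ℕ.* f y ℕ.≤ sum (map f xs)
  min≤average f default []       = default , z≤n
  min≤average f default (x ∷ xs) with min≤average f x xs
  ... | y , avg with ℕP.≤-total (f x) (f y)
  ... | inj₁ fx≤fy = x , ℕP.+-monoʳ-≤ (f x) (ℕP.≤-trans (ℕP.*-monoʳ-≤ (length xs) fx≤fy) avg)
  ... | inj₂ fy≤fx = y , ℕP.+-mono-≤ fy≤fx avg

  module _ {P : A → Set} (P? : ∀ x → Dec (P x)) where

    count-≥1 : ∀ {xs} → Any P xs → 1 ℕ.≤ count P? xs
    count-≥1 {x ∷ xs} (here px) with P? x
    ... | yes _  = s≤s z≤n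
    ... | no ¬px = ⊥-elim (¬px px)
    count-≥1 {x ∷ xs} (there any) = ℕP.≤-trans (count-≥1 any) (ℕP.m≤n+m _ (𝟙 (P? x)))

    count-≡0 : ∀ {xs} → All (¬_ ∘ P) xs → count P? xs ≡ 0
    count-≡0 []           = refl
    count-≡0 {x ∷ xs} (¬px ∷ ¬pxs) with P? x
    ... | yes px = ⊥-elim (¬px px)
    ... | no _   = count-≡0 ¬pxs

    count-≤1 : ∀ {xs} → Unique xs → (∀ {x y} → P x → P y → x ≡ y) → count P? xs ℕ.≤ 1
    count-≤1 []               _   = z≤n
    count-≤1 {x ∷ xs} (x∉ ∷ u) one with P? x
    ... | yes px = ℕP.≤-reflexive (cong suc (count-≡0 (All.map (λ x≢y py → x≢y (one px py)) x∉)))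
    ... | no _   = count-≤1 u one

  count-mono : ∀ {P Q : A → Set} (P? : ∀ x → Dec (P x)) (Q? : ∀ x → Dec (Q x)) →
               (∀ {x} → P x → Q x) → ∀ xs → count P? xs ℕ.≤ count Q? xs
  count-mono P? Q? P⇒Q []       = z≤n
  count-mono P? Q? P⇒Q (x ∷ xs) with P? x | Q? x
  ... | yes _  | yes _  = s≤s (count-mono P? Q? P⇒Q xs)
  ... | yes px | no ¬qx = ⊥-elim (¬qx (P⇒Q px))
  ... | no _   | yes _  = ℕP.m≤n⇒m≤1+n (count-mono P? Q? P⇒Q xs)
  ... | no _   | no _   = count-mono P? Q? P⇒Q xs

module _ {A : Set} {n : ℕ} where

  collisions : (A → Fin n) → List A → ℕ
  collisions g []       = 0
  collisions g (d ∷ D) = count (λ d′ → g d Fin.≟ g d′) D ℕ.+ collisions g D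

  length≤∣Z∣+collisions : ∀ (g : A → Fin n) D (Z : Subset n) → All ((_∈ Z) ∘ g) D →
                          length D ℕ.≤ ∣ Z ∣ ℕ.+ collisions g D
  length≤∣Z∣+collisions g []      Z []               = z≤n
  length≤∣Z∣+collisions g (d ∷ D) Z (gd∈Z ∷ gD⊆Z) with any? (λ d′ → g d Fin.≟ g d′) D
  ... | yes repeated = begin
    suc (length D)                              ≤⟨ s≤s (length≤∣Z∣+collisions g D Z gD⊆Z) ⟩
    suc (∣ Z ∣ ℕ.+ collisions g D)              ≡⟨ ℕP.+-suc ∣ Z ∣ (collisions g D) ⟨
    ∣ Z ∣ ℕ.+ (1 ℕ.+ collisions g D)            ≤⟨ ℕP.+-monoʳ-≤ ∣ Z ∣ (ℕP.+-monoˡ-≤ _ (count-≥1 _ repeated)) ⟩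
    ∣ Z ∣ ℕ.+ collisions g (d ∷ D)              ∎
    where open ℕP.≤-Reasoning
  ... | no new = begin
    suc (length D)                              ≤⟨ s≤s (length≤∣Z∣+collisions g D (Z Subset.- g d) gD⊆Z-gd) ⟩
    suc (∣ Z Subset.- g d ∣ ℕ.+ collisions g D) ≤⟨ ℕP.+-monoˡ-≤ _ (x∈p⇒∣p-x∣<∣p∣ gd∈Z) ⟩
    ∣ Z ∣ ℕ.+ collisions g D                    ≤⟨ ℕP.+-monoʳ-≤ ∣ Z ∣ (ℕP.m≤n+m _ _) ⟩
    ∣ Z ∣ ℕ.+ collisions g (d ∷ D)              ∎
    where
      open ℕP.≤-Reasoning
      gD⊆Z-gd : All ((_∈ Z Subset.- g d) ∘ g) D
      gD⊆Z-gd = All.tabulate λ {d′} d′∈D →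
        x∈p∧x≢y⇒x∈p-y (All.lookup gD⊆Z d′∈D) (λ gd′≡gd → new (lose d′∈D (sym gd′≡gd)))

  collisions-mono : ∀ {g h : A → Fin n} → (∀ {d d′} → g d ≡ g d′ → h d ≡ h d′) →
                    ∀ D → collisions g D ℕ.≤ collisions h D
  collisions-mono g⇒h []      = z≤n
  collisions-mono g⇒h (d ∷ D) = ℕP.+-mono-≤ (count-mono _ _ g⇒h D) (collisions-mono g⇒h D)

  collisions-≡0 : ∀ {g : A → Fin n} {D} → Unique D →
                  (∀ {d d′} → d ∈ₗ D → d′ ∈ₗ D → d ≢ d′ → g d ≢ g d′) → collisions g D ≡ 0
  collisions-≡0 []             injective = refl
  collisions-≡0 (d∉D ∷ unique) injective = cong₂ ℕ._+_
    (count-≡0 _ (All.tabulate (λ d′∈D → injective (here refl) (there d′∈D) (All.lookup d∉D d′∈D))))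
    (collisions-≡0 unique (λ d∈D d′∈D → injective (there d∈D) (there d′∈D)))

  ∑collisions≤C2 : ∀ {I : Set} (g : I → A → Fin n) {is} → Unique is →
                   (∀ {d d′} → d ≢ d′ → ∀ {i j} → g i d ≡ g i d′ → g j d ≡ g j d′ → i ≡ j) →
                   ∀ {D} → Unique D → sum (map (λ i → collisions (g i) D) is) ℕ.≤ length D C 2
  ∑collisions≤C2 g {is} unique-is unique-dir {[]} [] = ℕP.≤-reflexive (sum-map-0 is)
  ∑collisions≤C2 g {is} unique-is unique-dir {d ∷ D} (d∉D ∷ unique-D) = begin
    sum (map (λ i → collisions (g i) (d ∷ D)) is)                      ≡⟨ sum-map-+ (λ i → count (λ d′ → g i d Fin.≟ g i d′) D) _ is ⟩
    sum (map (λ i → count (λ d′ → g i d Fin.≟ g i d′) D) is) ℕ.+ _     ≤⟨ ℕP.+-mono-≤ (partners d∉D)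
                                                                             (∑collisions≤C2 g unique-is unique-dir unique-D) ⟩
    length D ℕ.+ length D C 2                                          ≡⟨ cong (ℕ._+ length D C 2) (nC1≡n (length D)) ⟨
    length D C 1 ℕ.+ length D C 2                                      ≡⟨ nCk+nC[k+1]≡[n+1]C[k+1] (length D) 1 ⟩
    suc (length D) C 2                                                 ∎
    where
      open ℕP.≤-Reasoning
      partners : ∀ {D} → All (d ≢_) D → sum (map (λ i → count (λ d′ → g i d Fin.≟ g i d′) D) is) ℕ.≤ length D
      partners {[]}     []              = ℕP.≤-reflexive (sum-map-0 is)
      partners {d′ ∷ D} (d≢d′ ∷ d∉D) = begin
        sum (map (λ i → 𝟙 (g i d Fin.≟ g i d′) ℕ.+ count (λ d″ → g i d Fin.≟ g i d″) D) is)  ≡⟨ sum-map-+ _ _ is ⟩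
        count (λ i → g i d Fin.≟ g i d′) is ℕ.+ _                                          ≤⟨ ℕP.+-mono-≤
                                                                  (count-≤1 _ unique-is (unique-dir d≢d′)) (partners d∉D) ⟩
        suc (length D)                                                                     ∎

module Directions (p : ℕ) .{{_ : NonZero p}} where

  open import Data.Integer using (_+_; _-_; _*_)
  open Residues p
  open import Relation.Binary.Reasoning.Setoid ≈-setoid

  φ : Fin p → Fin p × Fin p → Fin p
  φ ζ (x , y) = x +ₚ (ζ *ₚ y)

  ⟦φ⟧ : ∀ ζ x y → ⟦ φ ζ (x , y) ⟧ ≈ ⟦ x ⟧ + ⟦ ζ ⟧ * ⟦ y ⟧
  ⟦φ⟧ ζ x y = ≈-trans (⟦+ₚ⟧ x (ζ *ₚ y)) (+-cong (≈-refl {⟦ x ⟧}) (⟦*ₚ⟧ ζ y))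

  φ-collision : ∀ ζ {x y x′ y′} → φ ζ (x , y) ≡ φ ζ (x′ , y′) → ⟦ ζ ⟧ * (⟦ y ⟧ - ⟦ y′ ⟧) ≈ ⟦ x′ ⟧ - ⟦ x ⟧
  φ-collision ζ {x} {y} {x′} {y′} eq = ≈-transport values-agree (lemma ⟦ ζ ⟧ ⟦ x ⟧ ⟦ y ⟧ ⟦ x′ ⟧ ⟦ y′ ⟧)
    where
      values-agree : ⟦ x ⟧ + ⟦ ζ ⟧ * ⟦ y ⟧ ≈ ⟦ x′ ⟧ + ⟦ ζ ⟧ * ⟦ y′ ⟧
      values-agree = ≈-trans (≈-sym (⟦φ⟧ ζ x y)) (≈-trans (≈-reflexive (cong ⟦_⟧ eq)) (⟦φ⟧ ζ x′ y′))
      lemma : ∀ z x y x′ y′ → z * (y - y′) - (x′ - x) ≡ (x + z * y) - (x′ + z * y′)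
      lemma = solve-∀

  φ-injectiveˡ : ∀ ζ {x y x′} → φ ζ (x , y) ≡ φ ζ (x′ , y) → x ≡ x′
  φ-injectiveˡ ζ {x} {y} {x′} eq =
    sym (⟦⟧-injective (-≈0⇒≈ (≈-trans (≈-sym (φ-collision ζ eq)) (≈-reflexive (lemma ⟦ ζ ⟧ ⟦ y ⟧)))))
    where
      lemma : ∀ z y → z * (y - y) ≡ + 0
      lemma = solve-∀

  IsRatio : Subset p → Subset p → Fin p → Set
  IsRatio X Y ζ = ∃[ x₁ ] ∃[ x₂ ] ∃[ y₁ ] ∃[ y₂ ]
    x₁ ∈ X × x₂ ∈ X × y₁ ∈ Y × y₂ ∈ Y × y₁ ≢ y₂ × ζ *ₚ (y₁ -ₚ y₂) ≡ x₁ -ₚ x₂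

  isRatio? : ∀ X Y ζ → Dec (IsRatio X Y ζ)
  isRatio? X Y ζ = FinP.any? λ x₁ → FinP.any? λ x₂ → FinP.any? λ y₁ → FinP.any? λ y₂ →
    x₁ ∈? X ×-dec x₂ ∈? X ×-dec y₁ ∈? Y ×-dec y₂ ∈? Y ×-dec ¬? (y₁ Fin.≟ y₂) ×-dec ζ *ₚ (y₁ -ₚ y₂) Fin.≟ x₁ -ₚ x₂

  ⟦*-ₚ⟧ : ∀ ζ y₁ y₂ → ⟦ ζ *ₚ (y₁ -ₚ y₂) ⟧ ≈ ⟦ ζ ⟧ * (⟦ y₁ ⟧ - ⟦ y₂ ⟧)
  ⟦*-ₚ⟧ ζ y₁ y₂ = ≈-trans (⟦*ₚ⟧ ζ (y₁ -ₚ y₂)) (*-cong (≈-refl {⟦ ζ ⟧}) (⟦-ₚ⟧ y₁ y₂))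

  ratio⇒≈ : ∀ ζ x₁ x₂ y₁ y₂ → ζ *ₚ (y₁ -ₚ y₂) ≡ x₁ -ₚ x₂ →
            ⟦ ζ ⟧ * (⟦ y₁ ⟧ - ⟦ y₂ ⟧) ≈ ⟦ x₁ ⟧ - ⟦ x₂ ⟧
  ratio⇒≈ ζ x₁ x₂ y₁ y₂ eq =
    ≈-trans (≈-sym (⟦*-ₚ⟧ ζ y₁ y₂)) (≈-trans (≈-reflexive (cong ⟦_⟧ eq)) (⟦-ₚ⟧ x₁ x₂))

  ≈⇒ratio : ∀ ζ x₁ x₂ y₁ y₂ → ⟦ ζ ⟧ * (⟦ y₁ ⟧ - ⟦ y₂ ⟧) ≈ ⟦ x₁ ⟧ - ⟦ x₂ ⟧ →
            ζ *ₚ (y₁ -ₚ y₂) ≡ x₁ -ₚ x₂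
  ≈⇒ratio ζ x₁ x₂ y₁ y₂ h =
    ⟦⟧-injective (≈-trans (⟦*-ₚ⟧ ζ y₁ y₂) (≈-trans h (≈-sym (⟦-ₚ⟧ x₁ x₂))))

  x+ₚy-ₚy≡x : ∀ {c} ζ → (ζ +ₚ c) -ₚ c ≡ ζ
  x+ₚy-ₚy≡x {c} ζ = ⟦⟧-injective (begin
    ⟦ (ζ +ₚ c) -ₚ c ⟧      ≈⟨ ⟦-ₚ⟧ (ζ +ₚ c) c ⟩
    ⟦ ζ +ₚ c ⟧ - ⟦ c ⟧     ≈⟨ -cong (⟦+ₚ⟧ ζ c) (≈-refl {⟦ c ⟧}) ⟩
    ⟦ ζ ⟧ + ⟦ c ⟧ - ⟦ c ⟧  ≡⟨ lemma ⟦ ζ ⟧ ⟦ c ⟧ ⟩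
    ⟦ ζ ⟧                  ∎)
    where
      lemma : ∀ z c → z + c - c ≡ z
      lemma = solve-∀

  φ-injective : ∀ {X Y ζ} → ¬ IsRatio X Y ζ → ∀ {d d′} → (X ×ₛ Y) d → (X ×ₛ Y) d′ → d ≢ d′ → φ ζ d ≢ φ ζ d′
  φ-injective {ζ = ζ} ¬ratio {x , y} {x′ , y′} (x∈X , y∈Y) (x′∈X , y′∈Y) d≢d′ eq with y Fin.≟ y′
  ... | yes refl = d≢d′ (cong (_, y) (φ-injectiveˡ ζ eq))
  ... | no y≢y′  = ¬ratio (x′ , x , y , y′ , x′∈X , x∈X , y∈Y , y′∈Y , y≢y′ , ≈⇒ratio ζ x′ x y y′ (φ-collision ζ eq))

  CombinationsIn : Fin p → Subset p → Subset p → Subset p → Set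
  CombinationsIn c X Y Z = ∀ {x x₁ x₂ y y₁ y₂ z} → x ∈ X → x₁ ∈ X → x₂ ∈ X → y ∈ Y → y₁ ∈ Y → y₂ ∈ Y →
    ⟦ z ⟧ ≈ (⟦ y₁ ⟧ - ⟦ y₂ ⟧) * ⟦ x ⟧ + (⟦ x₁ ⟧ - ⟦ x₂ ⟧ + ⟦ c ⟧ * (⟦ y₁ ⟧ - ⟦ y₂ ⟧)) * ⟦ y ⟧ → z ∈ Z

  module _ (prime : Prime p) where

    open Field prime

    φ-direction-unique : ∀ {d d′} → d ≢ d′ → ∀ {ζ₁ ζ₂} → φ ζ₁ d ≡ φ ζ₁ d′ → φ ζ₂ d ≡ φ ζ₂ d′ → ζ₁ ≡ ζ₂
    φ-direction-unique {x , y} {x′ , y′} d≢d′ {ζ₁} {ζ₂} e₁ e₂ with y Fin.≟ y′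
    ... | yes refl = ⊥-elim (d≢d′ (cong (_, y) (φ-injectiveˡ ζ₁ e₁)))
    ... | no y≢y′  = ⟦⟧-injective (*-cancelˡ-≈ (⟦ y ⟧ - ⟦ y′ ⟧) (≢⇒-≉0 y≢y′) (begin
      (⟦ y ⟧ - ⟦ y′ ⟧) * ⟦ ζ₁ ⟧ ≡⟨ ℤP.*-comm (⟦ y ⟧ - ⟦ y′ ⟧) ⟦ ζ₁ ⟧ ⟩
      ⟦ ζ₁ ⟧ * (⟦ y ⟧ - ⟦ y′ ⟧) ≈⟨ φ-collision ζ₁ e₁ ⟩
      ⟦ x′ ⟧ - ⟦ x ⟧            ≈⟨ φ-collision ζ₂ e₂ ⟨
      ⟦ ζ₂ ⟧ * (⟦ y ⟧ - ⟦ y′ ⟧) ≡⟨ ℤP.*-comm ⟦ ζ₂ ⟧ (⟦ y ⟧ - ⟦ y′ ⟧) ⟩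
      (⟦ y ⟧ - ⟦ y′ ⟧) * ⟦ ζ₂ ⟧ ∎))

    length≤∣Z∣+collisions-φ : ∀ {c X Y Z} → CombinationsIn c X Y Z → ∀ {ζ} → IsRatio X Y (ζ -ₚ c) →
                              ∀ {D} → All (X ×ₛ Y) D → length D ℕ.≤ ∣ Z ∣ ℕ.+ collisions (φ ζ) D
    length≤∣Z∣+collisions-φ {c} {X} {Y} {Z} combinations {ζ}
                            (x₁ , x₂ , y₁ , y₂ , x₁∈X , x₂∈X , y₁∈Y , y₂∈Y , y₁≢y₂ , eq) {D} D⊆X×Y =
      ℕP.≤-trans (length≤∣Z∣+collisions ψ D Z (All.map ψ∈Z D⊆X×Y)) (ℕP.+-monoʳ-≤ ∣ Z ∣ (collisions-mono ψ⇒φ D))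
      where
        t : Fin p
        t = y₁ -ₚ y₂
        T : ℤ
        T = ⟦ y₁ ⟧ - ⟦ y₂ ⟧

        ψ : Fin p × Fin p → Fin p
        ψ d = t *ₚ φ ζ d

        ⟦ψ⟧ : ∀ d → ⟦ ψ d ⟧ ≈ T * ⟦ φ ζ d ⟧
        ⟦ψ⟧ d = ≈-trans (⟦*ₚ⟧ t (φ ζ d)) (*-cong (⟦-ₚ⟧ y₁ y₂) (≈-refl {⟦ φ ζ d ⟧}))

        ψ⇒φ : ∀ {d d′} → ψ d ≡ ψ d′ → φ ζ d ≡ φ ζ d′
        ψ⇒φ {d} {d′} eq′ = ⟦⟧-injective (*-cancelˡ-≈ T (≢⇒-≉0 y₁≢y₂)
          (≈-trans (≈-sym (⟦ψ⟧ d)) (≈-trans (≈-reflexive (cong ⟦_⟧ eq′)) (⟦ψ⟧ d′))))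

        ζT : ⟦ ζ ⟧ * T ≈ ⟦ x₁ ⟧ - ⟦ x₂ ⟧ + ⟦ c ⟧ * T
        ζT = begin
          ⟦ ζ ⟧ * T                           ≡⟨ lemma ⟦ ζ ⟧ ⟦ c ⟧ T ⟩
          (⟦ ζ ⟧ - ⟦ c ⟧) * T + ⟦ c ⟧ * T     ≈⟨ +-cong (*-cong (⟦-ₚ⟧ ζ c) (≈-refl {T})) (≈-refl {⟦ c ⟧ * T}) ⟨
          ⟦ ζ -ₚ c ⟧ * T + ⟦ c ⟧ * T          ≈⟨ +-cong (ratio⇒≈ (ζ -ₚ c) x₁ x₂ y₁ y₂ eq) (≈-refl {⟦ c ⟧ * T}) ⟩
          ⟦ x₁ ⟧ - ⟦ x₂ ⟧ + ⟦ c ⟧ * T         ∎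
          where
            lemma : ∀ z c t → z * t ≡ (z - c) * t + c * t
            lemma = solve-∀

        ψ∈Z : ∀ {d} → (X ×ₛ Y) d → ψ d ∈ Z
        ψ∈Z {x , y} (x∈X , y∈Y) = combinations x∈X x₁∈X x₂∈X y∈Y y₁∈Y y₂∈Y (begin
          ⟦ ψ (x , y) ⟧                           ≈⟨ ⟦ψ⟧ (x , y) ⟩
          T * ⟦ φ ζ (x , y) ⟧                     ≈⟨ *-cong (≈-refl {T}) (⟦φ⟧ ζ x y) ⟩
          T * (⟦ x ⟧ + ⟦ ζ ⟧ * ⟦ y ⟧)             ≡⟨ lemma T ⟦ x ⟧ ⟦ ζ ⟧ ⟦ y ⟧ ⟩
          T * ⟦ x ⟧ + ⟦ ζ ⟧ * T * ⟦ y ⟧           ≈⟨ +-cong (≈-refl {T * ⟦ x ⟧}) (*-cong ζT (≈-refl {⟦ y ⟧})) ⟩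
          T * ⟦ x ⟧ + (⟦ x₁ ⟧ - ⟦ x₂ ⟧ + ⟦ c ⟧ * T) * ⟦ y ⟧ ∎)
          where
            lemma : ∀ t x z y → t * (x + z * y) ≡ t * x + z * t * y
            lemma = solve-∀

    good-direction : ∀ {X Y} c → ⟦ c ⟧ ≉ + 0 → ∀ {x₀ y₁ y₂} → x₀ ∈ X → y₁ ∈ Y → y₂ ∈ Y → y₁ ≢ y₂ →
                     ∀ {D} → Unique D → All (X ×ₛ Y) D →
                     ∃[ ζ ] IsRatio X Y (ζ -ₚ c) × p ℕ.* collisions (φ ζ) D ℕ.≤ length D C 2
    good-direction {X} {Y} c c≉0 {x₀} {y₁} {y₂} x₀∈X y₁∈Y y₂∈Y y₁≢y₂ {D} unique-D D⊆X×Y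
      with FinP.any? (λ ζ → isRatio? X Y ζ ×-dec ¬? (isRatio? X Y (ζ +ₚ c)))
    ... | yes (ζ , ratio , ¬ratio) = ζ +ₚ c , subst (IsRatio X Y) (sym (x+ₚy-ₚy≡x ζ)) ratio ,
          ℕP.≤-trans (ℕP.≤-reflexive (trans (cong (p ℕ.*_) no-collisions) (ℕP.*-zeroʳ p))) z≤n
      where
        no-collisions : collisions (φ (ζ +ₚ c)) D ≡ 0
        no-collisions = collisions-≡0 unique-D (λ d∈D d′∈D →
          φ-injective {ζ = ζ +ₚ c} ¬ratio (All.lookup D⊆X×Y d∈D) (All.lookup D⊆X×Y d′∈D))
    ... | no no-exit with min≤average (λ ζ → collisions (φ ζ) D) c (allFin p)
    ... | ζ₀ , average = ζ₀ , every-ratio (ζ₀ -ₚ c) ,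
          ℕP.≤-trans (subst (λ n → n ℕ.* collisions (φ ζ₀) D ℕ.≤ sum (map (λ ζ → collisions (φ ζ) D) (allFin p)))
                            (ListP.length-tabulate {n = p} id) average)
                     (∑collisions≤C2 φ (UniqueP.allFin⁺ p) φ-direction-unique unique-D)
      where
        closed : ∀ {ζ} → IsRatio X Y ζ → IsRatio X Y (ζ +ₚ c)
        closed {ζ} ratio with isRatio? X Y (ζ +ₚ c)
        ... | yes ratio′ = ratio′
        ... | no ¬ratio′ = ⊥-elim (no-exit (ζ , ratio , ¬ratio′))

        zero-ratio : IsRatio X Y (x₀ -ₚ x₀)
        zero-ratio = x₀ , x₀ , y₁ , y₂ , x₀∈X , x₀∈X , y₁∈Y , y₂∈Y , y₁≢y₂ , ≈⇒ratio (x₀ -ₚ x₀) x₀ x₀ y₁ y₂ (begin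
          ⟦ x₀ -ₚ x₀ ⟧ * (⟦ y₁ ⟧ - ⟦ y₂ ⟧)      ≈⟨ *-cong (⟦-ₚ⟧ x₀ x₀) (≈-refl {⟦ y₁ ⟧ - ⟦ y₂ ⟧}) ⟩
          (⟦ x₀ ⟧ - ⟦ x₀ ⟧) * (⟦ y₁ ⟧ - ⟦ y₂ ⟧) ≡⟨ lemma ⟦ x₀ ⟧ (⟦ y₁ ⟧ - ⟦ y₂ ⟧) ⟩
          ⟦ x₀ ⟧ - ⟦ x₀ ⟧                       ∎)
          where
            lemma : ∀ x t → (x - x) * t ≡ x - x
            lemma = solve-∀

        every-ratio : ∀ ζ → IsRatio X Y ζ
        every-ratio = +ₚ-induction (IsRatio X Y) c c≉0 {x₀ -ₚ x₀} zero-ratio closed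

    combinations-bound : ∀ {c X Y Z} → ⟦ c ⟧ ≉ + 0 → CombinationsIn c X Y Z →
                         ∀ {x₀ y₁ y₂} → x₀ ∈ X → y₁ ∈ Y → y₂ ∈ Y → y₁ ≢ y₂ →
                         ∀ {w} → w ℕ.≤ ∣ X ∣ ℕ.* ∣ Y ∣ → p ℕ.* (w ∸ ∣ Z ∣) ℕ.≤ w C 2
    combinations-bound {c} {X} {Y} {Z} c≉0 combinations x₀∈X y₁∈Y y₂∈Y y₁≢y₂ w≤∣X×Y∣
      with distinct-pairs X Y w≤∣X×Y∣
    ... | D , refl , unique-D , D⊆X×Y with good-direction c c≉0 x₀∈X y₁∈Y y₂∈Y y₁≢y₂ unique-D D⊆X×Y
    ... | ζ , ratio , few-collisions = ℕP.≤-trans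
      (ℕP.*-monoʳ-≤ p (ℕP.m≤n+o⇒m∸n≤o (length D) ∣ Z ∣ (length≤∣Z∣+collisions-φ {c} combinations {ζ} ratio D⊆X×Y)))
      few-collisions

N-from : ∀ k n → 5 ℕ.* 4 ^ k ≡ n ℕ.* 24 ℕ.+ 8 → N k ≡ n
N-from k n eq = begin
  (5 ℕ.* 4 ^ k ∸ 8) ℕ./ 24        ≡⟨ cong (λ m → (m ∸ 8) ℕ./ 24) eq ⟩
  (n ℕ.* 24 ℕ.+ 8 ∸ 8) ℕ./ 24     ≡⟨ cong (ℕ._/ 24) (ℕP.m+n∸n≡m (n ℕ.* 24) 8) ⟩
  n ℕ.* 24 ℕ./ 24                 ≡⟨ m*n/n≡m n 24 ⟩
  n                               ∎
  where open ≡-Reasoning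

four-times : ∀ x n → 5 ℕ.* x ≡ n ℕ.* 24 ℕ.+ 8 → 5 ℕ.* (4 ℕ.* x) ≡ (4 ℕ.* n ℕ.+ 1) ℕ.* 24 ℕ.+ 8
four-times x n eq = begin
  5 ℕ.* (4 ℕ.* x)               ≡⟨ lemma x ⟩
  4 ℕ.* (5 ℕ.* x)               ≡⟨ cong (4 ℕ.*_) eq ⟩
  4 ℕ.* (n ℕ.* 24 ℕ.+ 8)        ≡⟨ lemma′ n ⟩
  (4 ℕ.* n ℕ.+ 1) ℕ.* 24 ℕ.+ 8  ∎
  where
    open ≡-Reasoning
    lemma : ∀ x → 5 ℕ.* (4 ℕ.* x) ≡ 4 ℕ.* (5 ℕ.* x)
    lemma = ℕsolve-∀
    lemma′ : ∀ n → 4 ℕ.* (n ℕ.* 24 ℕ.+ 8) ≡ (4 ℕ.* n ℕ.+ 1) ℕ.* 24 ℕ.+ 8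
    lemma′ = ℕsolve-∀

five·4^ : ∀ j → 5 ℕ.* 4 ^ (2 ℕ.+ j) ≡ N (2 ℕ.+ j) ℕ.* 24 ℕ.+ 8
five·4^ zero    = refl
five·4^ (suc j) = trans next (cong (λ n → n ℕ.* 24 ℕ.+ 8) (sym (N-from (3 ℕ.+ j) (4 ℕ.* N (2 ℕ.+ j) ℕ.+ 1) next)))
  where
    next : 5 ℕ.* 4 ^ (3 ℕ.+ j) ≡ (4 ℕ.* N (2 ℕ.+ j) ℕ.+ 1) ℕ.* 24 ℕ.+ 8
    next = four-times (4 ^ (2 ℕ.+ j)) (N (2 ℕ.+ j)) (five·4^ j)

N-suc : ∀ j → N (3 ℕ.+ j) ≡ 4 ℕ.* N (2 ℕ.+ j) ℕ.+ 1
N-suc j = N-from (3 ℕ.+ j) (4 ℕ.* N (2 ℕ.+ j) ℕ.+ 1) (four-times (4 ^ (2 ℕ.+ j)) (N (2 ℕ.+ j)) (five·4^ j))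

N-nonZero : ∀ j → NonZero (N (2 ℕ.+ j))
N-nonZero zero    = _
N-nonZero (suc j) = subst NonZero (sym (trans (N-suc j) (ℕP.+-comm _ 1))) _

module Sumsets (p : ℕ) .{{_ : NonZero p}} where

  open import Data.Integer using (_+_; _-_; _*_; -_)
  open Residues p
  open import Relation.Binary.Reasoning.Setoid ≈-setoid

  Σ⟦_⟧ : List (Fin p) → ℤ
  Σ⟦ [] ⟧    = + 0
  Σ⟦ a ∷ l ⟧ = ⟦ a ⟧ + Σ⟦ l ⟧

  Σ⟦++⟧ : ∀ l m → Σ⟦ l List.++ m ⟧ ≡ Σ⟦ l ⟧ + Σ⟦ m ⟧
  Σ⟦++⟧ []      m = sym (ℤP.+-identityˡ Σ⟦ m ⟧)
  Σ⟦++⟧ (a ∷ l) m = trans (cong (λ s → ⟦ a ⟧ + s) (Σ⟦++⟧ l m)) (sym (ℤP.+-assoc ⟦ a ⟧ Σ⟦ l ⟧ Σ⟦ m ⟧))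

  Σ⟦map*ₚ⟧ : ∀ t l → Σ⟦ map (_*ₚ t) l ⟧ ≈ Σ⟦ l ⟧ * ⟦ t ⟧
  Σ⟦map*ₚ⟧ t []      = ≈-refl
  Σ⟦map*ₚ⟧ t (a ∷ l) = ≈-trans (+-cong (⟦*ₚ⟧ a t) (Σ⟦map*ₚ⟧ t l)) (≈-reflexive (sym (ℤP.*-distribʳ-+ ⟦ t ⟧ ⟦ a ⟧ Σ⟦ l ⟧)))

  ∈-sumMul⁻ : ∀ m {S z} → z ∈ sumMul m S → ∃[ l ] length l ≡ suc m × All (_∈ S) l × ⟦ z ⟧ ≈ Σ⟦ l ⟧
  ∈-sumMul⁻ zero    {z = z} z∈S = z ∷ [] , refl , z∈S ∷ [] , ≈-reflexive (sym (ℤP.+-identityʳ ⟦ z ⟧))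
  ∈-sumMul⁻ (suc m) z∈ with ∈-image₂⁻ _+ₚ_ z∈
  ... | u , s , u∈ , s∈S , refl with ∈-sumMul⁻ m u∈
  ... | l , ∣l∣ , l⊆S , u≈l = s ∷ l , cong suc ∣l∣ , s∈S ∷ l⊆S ,
        ≈-trans (⟦+ₚ⟧ u s) (≈-trans (+-cong u≈l (≈-refl {⟦ s ⟧})) (≈-reflexive (ℤP.+-comm Σ⟦ l ⟧ ⟦ s ⟧)))

  ∈-sumMul⁺ : ∀ m {S} l → length l ≡ suc m → All (_∈ S) l → ∃[ z ] z ∈ sumMul m S × ⟦ z ⟧ ≈ Σ⟦ l ⟧
  ∈-sumMul⁺ zero    (a ∷ []) _ (a∈S ∷ []) = a , a∈S , ≈-reflexive (sym (ℤP.+-identityʳ ⟦ a ⟧))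
  ∈-sumMul⁺ (suc m) (a ∷ l) ∣l∣ (a∈S ∷ l⊆S) with ∈-sumMul⁺ m l (ℕP.suc-injective ∣l∣) l⊆S
  ... | u , u∈ , u≈l = u +ₚ a , ∈-image₂⁺ _+ₚ_ u∈ a∈S ,
        ≈-trans (⟦+ₚ⟧ u a) (≈-trans (+-cong u≈l (≈-refl {⟦ a ⟧})) (≈-reflexive (ℤP.+-comm Σ⟦ l ⟧ ⟦ a ⟧)))

  record SignedSum (S : Subset p) (n : ℕ) (v : ℤ) : Set where
    field
      pos neg    : List (Fin p)
      length-pos : length pos ≡ n
      length-neg : length neg ≡ n
      pos⊆S      : All (_∈ S) pos
      neg⊆S      : All (_∈ S) neg
      value      : v ≈ Σ⟦ pos ⟧ - Σ⟦ neg ⟧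
  open SignedSum

  SignedSum-cong : ∀ {S n u v} → u ≈ v → SignedSum S n u → SignedSum S n v
  SignedSum-cong u≈v σ = record
    { pos = pos σ ; neg = neg σ ; length-pos = length-pos σ ; length-neg = length-neg σ
    ; pos⊆S = pos⊆S σ ; neg⊆S = neg⊆S σ ; value = ≈-trans (≈-sym u≈v) (value σ) }

  pair : ∀ {S s t} → s ∈ S → t ∈ S → SignedSum S 1 (⟦ s ⟧ - ⟦ t ⟧)
  pair {s = s} {t} s∈S t∈S = record
    { pos = s ∷ [] ; neg = t ∷ [] ; length-pos = refl ; length-neg = refl
    ; pos⊆S = s∈S ∷ [] ; neg⊆S = t∈S ∷ []
    ; value = ≈-reflexive (cong₂ _-_ (sym (ℤP.+-identityʳ ⟦ s ⟧)) (sym (ℤP.+-identityʳ ⟦ t ⟧))) }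

  negate : ∀ {S n v} → SignedSum S n v → SignedSum S n (- v)
  negate σ = record
    { pos = neg σ ; neg = pos σ ; length-pos = length-neg σ ; length-neg = length-pos σ
    ; pos⊆S = neg⊆S σ ; neg⊆S = pos⊆S σ
    ; value = ≈-trans (-‿cong (value σ)) (≈-reflexive (lemma Σ⟦ pos σ ⟧ Σ⟦ neg σ ⟧)) }
    where
      lemma : ∀ a b → - (a - b) ≡ b - a
      lemma = solve-∀

  _⊹_ : ∀ {S m n u v} → SignedSum S m u → SignedSum S n v → SignedSum S (m ℕ.+ n) (u + v)
  _⊹_ {u = u} {v} σ τ = record
    { pos = pos σ List.++ pos τ ; neg = neg σ List.++ neg τ
    ; length-pos = trans (ListP.length-++ (pos σ)) (cong₂ ℕ._+_ (length-pos σ) (length-pos τ))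
    ; length-neg = trans (ListP.length-++ (neg σ)) (cong₂ ℕ._+_ (length-neg σ) (length-neg τ))
    ; pos⊆S = AllP.++⁺ (pos⊆S σ) (pos⊆S τ) ; neg⊆S = AllP.++⁺ (neg⊆S σ) (neg⊆S τ)
    ; value = begin
        u + v                                              ≈⟨ +-cong (value σ) (value τ) ⟩
        (Σ⟦ pos σ ⟧ - Σ⟦ neg σ ⟧) + (Σ⟦ pos τ ⟧ - Σ⟦ neg τ ⟧) ≡⟨ lemma Σ⟦ pos σ ⟧ Σ⟦ neg σ ⟧ Σ⟦ pos τ ⟧ Σ⟦ neg τ ⟧ ⟩
        (Σ⟦ pos σ ⟧ + Σ⟦ pos τ ⟧) - (Σ⟦ neg σ ⟧ + Σ⟦ neg τ ⟧) ≡⟨ cong₂ _-_ (Σ⟦++⟧ (pos σ) (pos τ)) (Σ⟦++⟧ (neg σ) (neg τ)) ⟨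
        Σ⟦ pos σ List.++ pos τ ⟧ - Σ⟦ neg σ List.++ neg τ ⟧ ∎ }
    where
      lemma : ∀ a b c d → (a - b) + (c - d) ≡ (a + c) - (b + d)
      lemma = solve-∀

  scale : ∀ {S T n v t} → SignedSum S n v → t ∈ T → SignedSum (S ⊗ T) n (v * ⟦ t ⟧)
  scale {v = v} {t} σ t∈T = record
    { pos = map (_*ₚ t) (pos σ) ; neg = map (_*ₚ t) (neg σ)
    ; length-pos = trans (ListP.length-map (_*ₚ t) (pos σ)) (length-pos σ)
    ; length-neg = trans (ListP.length-map (_*ₚ t) (neg σ)) (length-neg σ)
    ; pos⊆S = AllP.map⁺ (All.map (λ s∈S → ∈-image₂⁺ _*ₚ_ s∈S t∈T) (pos⊆S σ))
    ; neg⊆S = AllP.map⁺ (All.map (λ s∈S → ∈-image₂⁺ _*ₚ_ s∈S t∈T) (neg⊆S σ))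
    ; value = begin
        v * ⟦ t ⟧                                           ≈⟨ *-cong (value σ) (≈-refl {⟦ t ⟧}) ⟩
        (Σ⟦ pos σ ⟧ - Σ⟦ neg σ ⟧) * ⟦ t ⟧                   ≡⟨ lemma Σ⟦ pos σ ⟧ Σ⟦ neg σ ⟧ ⟦ t ⟧ ⟩
        Σ⟦ pos σ ⟧ * ⟦ t ⟧ - Σ⟦ neg σ ⟧ * ⟦ t ⟧             ≈⟨ -cong (Σ⟦map*ₚ⟧ t (pos σ)) (Σ⟦map*ₚ⟧ t (neg σ)) ⟨
        Σ⟦ map (_*ₚ t) (pos σ) ⟧ - Σ⟦ map (_*ₚ t) (neg σ) ⟧ ∎ }
    where
      lemma : ∀ a b t → (a - b) * t ≡ a * t - b * t
      lemma = solve-∀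

  ∈-mulSet-⊖⁻ : ∀ n → NonZero n → ∀ {S z} → z ∈ mulSet n S ⊖ mulSet n S → SignedSum S n ⟦ z ⟧
  ∈-mulSet-⊖⁻ (suc m) _ z∈ with ∈-image₂⁻ _-ₚ_ z∈
  ... | u , v , u∈ , v∈ , refl with ∈-sumMul⁻ m u∈ | ∈-sumMul⁻ m v∈
  ... | P , ∣P∣ , P⊆S , u≈P | Q , ∣Q∣ , Q⊆S , v≈Q = record
    { pos = P ; neg = Q ; length-pos = ∣P∣ ; length-neg = ∣Q∣ ; pos⊆S = P⊆S ; neg⊆S = Q⊆S
    ; value = ≈-trans (⟦-ₚ⟧ u v) (-cong u≈P v≈Q) }

  ∈-mulSet-⊖⁺ : ∀ n → NonZero n → ∀ {S z} → SignedSum S n ⟦ z ⟧ → z ∈ mulSet n S ⊖ mulSet n S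
  ∈-mulSet-⊖⁺ (suc m) _ {S} {z} σ
    with ∈-sumMul⁺ m (pos σ) (length-pos σ) (pos⊆S σ) | ∈-sumMul⁺ m (neg σ) (length-neg σ) (neg⊆S σ)
  ... | u , u∈ , u≈pos | v , v∈ , v≈neg = subst (_∈ mulSet (suc m) S ⊖ mulSet (suc m) S) u-v≡z (∈-image₂⁺ _-ₚ_ u∈ v∈)
    where
      u-v≡z : u -ₚ v ≡ z
      u-v≡z = ⟦⟧-injective (≈-trans (⟦-ₚ⟧ u v) (≈-trans (-cong u≈pos v≈neg) (≈-sym (value σ))))

  zero-sum : ∀ {S e} n → e ∈ S → SignedSum S n (+ 0)
  zero-sum zero    e∈S = record
    { pos = [] ; neg = [] ; length-pos = refl ; length-neg = refl ; pos⊆S = [] ; neg⊆S = [] ; value = ≈-refl }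
  zero-sum {e = e} (suc n) e∈S = SignedSum-cong (≈-reflexive (lemma ⟦ e ⟧)) (pair e∈S e∈S ⊹ zero-sum n e∈S)
    where
      lemma : ∀ e → (e - e) + + 0 ≡ + 0
      lemma = solve-∀

module Closure (p : ℕ) .{{_ : NonZero p}} where

  open import Data.Integer using (_+_; _-_; _*_; -_)
  open Residues p
  open Directions p using (CombinationsIn)
  open Sumsets p
  open import Relation.Binary.Reasoning.Setoid ≈-setoid

  ∈Aₖ⁻ : ∀ {A} j {z} → z ∈ Aₖ A (2 ℕ.+ j) → SignedSum (pow A (2 ℕ.+ j)) (N (2 ℕ.+ j)) ⟦ z ⟧
  ∈Aₖ⁻ j = ∈-mulSet-⊖⁻ (N (2 ℕ.+ j)) (N-nonZero j)

  ∈Aₖ⁺ : ∀ {A} j {z} → SignedSum (pow A (2 ℕ.+ j)) (N (2 ℕ.+ j)) ⟦ z ⟧ → z ∈ Aₖ A (2 ℕ.+ j)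
  ∈Aₖ⁺ j = ∈-mulSet-⊖⁺ (N (2 ℕ.+ j)) (N-nonZero j)

  zero∈Aₖ : ∀ {A e} j → e ∈ pow A (2 ℕ.+ j) → 0 mod p ∈ Aₖ A (2 ℕ.+ j)
  zero∈Aₖ j e∈ = ∈Aₖ⁺ j (SignedSum-cong (≈-sym (⟦mod⟧ 0)) (zero-sum (N (2 ℕ.+ j)) e∈))

  combinations-A₂ : ∀ A {c} → ⟦ c ⟧ ≈ + 1 → CombinationsIn c A A (Aₖ A 2)
  combinations-A₂ A {c} c≈1 {x} {x₁} {x₂} {y} {y₁} {y₂} {z} x∈A x₁∈A x₂∈A y∈A y₁∈A y₂∈A z≈ =
    ∈Aₖ⁺ 0 (SignedSum-cong value≈z
      (scale (pair y₁∈A y₂∈A) x∈A ⊹ (scale (pair x₁∈A x₂∈A) y∈A ⊹ scale (pair y₁∈A y₂∈A) y∈A)))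
    where
      X X₁ X₂ Y Y₁ Y₂ : ℤ
      X = ⟦ x ⟧ ; X₁ = ⟦ x₁ ⟧ ; X₂ = ⟦ x₂ ⟧ ; Y = ⟦ y ⟧ ; Y₁ = ⟦ y₁ ⟧ ; Y₂ = ⟦ y₂ ⟧
      lemma : ∀ x x₁ x₂ y y₁ y₂ →
        (y₁ - y₂) * x + ((x₁ - x₂) * y + (y₁ - y₂) * y) ≡ (y₁ - y₂) * x + (x₁ - x₂ + + 1 * (y₁ - y₂)) * y
      lemma = solve-∀
      value≈z : (Y₁ - Y₂) * X + ((X₁ - X₂) * Y + (Y₁ - Y₂) * Y) ≈ ⟦ z ⟧
      value≈z = begin
        (Y₁ - Y₂) * X + ((X₁ - X₂) * Y + (Y₁ - Y₂) * Y)  ≡⟨ lemma X X₁ X₂ Y Y₁ Y₂ ⟩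
        (Y₁ - Y₂) * X + (X₁ - X₂ + + 1 * (Y₁ - Y₂)) * Y  ≈⟨ +-cong (≈-refl {(Y₁ - Y₂) * X})
                                                              (*-cong (+-cong (≈-refl {X₁ - X₂}) (*-cong c≈1 (≈-refl {Y₁ - Y₂}))) (≈-refl {Y})) ⟨
        (Y₁ - Y₂) * X + (X₁ - X₂ + ⟦ c ⟧ * (Y₁ - Y₂)) * Y ≈⟨ z≈ ⟨
        ⟦ z ⟧                                            ∎

  combinations-Aₖ : ∀ A j {c} → c ∈ prodPow A j → CombinationsIn c (Aₖ A (2 ℕ.+ j)) A (Aₖ A (3 ℕ.+ j))
  combinations-Aₖ A j {c} c∈ {x} {x₁} {x₂} {y} {y₁} {y₂} {z} x∈ x₁∈ x₂∈ y∈A y₁∈A y₂∈A z≈ =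
    ∈Aₖ⁺ (suc j) (subst (λ n → SignedSum (pow A (3 ℕ.+ j)) n ⟦ z ⟧) (sym (trans (N-suc j) (size n)))
      (SignedSum-cong value≈z
        ((scale σ y₁∈A ⊹ negate (scale σ y₂∈A)) ⊹
         ((scale σ₁ y∈A ⊹ negate (scale σ₂ y∈A)) ⊹
          scale (pair (∈-image₂⁺ _*ₚ_ c∈ y₁∈A) (∈-image₂⁺ _*ₚ_ c∈ y₂∈A)) y∈A))))
    where
      n : ℕ
      n = N (2 ℕ.+ j)
      σ : SignedSum (pow A (2 ℕ.+ j)) n ⟦ x ⟧
      σ = ∈Aₖ⁻ j x∈
      σ₁ : SignedSum (pow A (2 ℕ.+ j)) n ⟦ x₁ ⟧
      σ₁ = ∈Aₖ⁻ j x₁∈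
      σ₂ : SignedSum (pow A (2 ℕ.+ j)) n ⟦ x₂ ⟧
      σ₂ = ∈Aₖ⁻ j x₂∈
      size : ∀ n → 4 ℕ.* n ℕ.+ 1 ≡ (n ℕ.+ n) ℕ.+ ((n ℕ.+ n) ℕ.+ 1)
      size = ℕsolve-∀
      lemma : ∀ x x₁ x₂ y y₁ y₂ c →
        x * y₁ + - (x * y₂) + ((x₁ * y + - (x₂ * y)) + (c * y₁ - c * y₂) * y)
          ≡ (y₁ - y₂) * x + (x₁ - x₂ + c * (y₁ - y₂)) * y
      lemma = solve-∀
      X X₁ X₂ Y Y₁ Y₂ C : ℤ
      X = ⟦ x ⟧ ; X₁ = ⟦ x₁ ⟧ ; X₂ = ⟦ x₂ ⟧ ; Y = ⟦ y ⟧ ; Y₁ = ⟦ y₁ ⟧ ; Y₂ = ⟦ y₂ ⟧ ; C = ⟦ c ⟧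
      value≈z : X * Y₁ + - (X * Y₂) + ((X₁ * Y + - (X₂ * Y)) + (⟦ c *ₚ y₁ ⟧ - ⟦ c *ₚ y₂ ⟧) * Y) ≈ ⟦ z ⟧
      value≈z = begin
        X * Y₁ + - (X * Y₂) + ((X₁ * Y + - (X₂ * Y)) + (⟦ c *ₚ y₁ ⟧ - ⟦ c *ₚ y₂ ⟧) * Y)
          ≈⟨ +-cong (≈-refl {X * Y₁ + - (X * Y₂)})
               (+-cong (≈-refl {X₁ * Y + - (X₂ * Y)}) (*-cong (-cong (⟦*ₚ⟧ c y₁) (⟦*ₚ⟧ c y₂)) (≈-refl {Y}))) ⟩
        X * Y₁ + - (X * Y₂) + ((X₁ * Y + - (X₂ * Y)) + (C * Y₁ - C * Y₂) * Y)
          ≡⟨ lemma X X₁ X₂ Y Y₁ Y₂ C ⟩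
        (Y₁ - Y₂) * X + (X₁ - X₂ + C * (Y₁ - Y₂)) * Y
          ≈⟨ z≈ ⟨
        ⟦ z ⟧ ∎

module QuadraticBounds where

  open import Data.Nat using (_+_; _*_; _≤_; _<_)

  -- 4qU − 5U² ≤ 4qs for every rational U = n/d in [0, K], with denominators cleared.
  QuadraticBound : ℕ → ℕ → ℕ → Set
  QuadraticBound q K s = ∀ n d → 1 ≤ d → n ≤ d * K → 4 * q * n * d ≤ 5 * n * n + 4 * q * (d * d) * s

  quadraticBound-base : ∀ q {K s} → K ≤ s → QuadraticBound q K s
  quadraticBound-base q {K} {s} K≤s n d _ n≤dK = begin
    4 * q * n * d             ≤⟨ ℕP.*-monoˡ-≤ d (ℕP.*-monoʳ-≤ (4 * q) (ℕP.≤-trans n≤dK (ℕP.*-monoʳ-≤ d K≤s))) ⟩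
    4 * q * (d * s) * d       ≡⟨ lemma q d s ⟩
    4 * q * (d * d) * s       ≤⟨ ℕP.m≤n+m _ (5 * n * n) ⟩
    5 * n * n + 4 * q * (d * d) * s ∎
    where
      open ℕP.≤-Reasoning
      lemma : ∀ q d s → 4 * q * (d * s) * d ≡ 4 * q * (d * d) * s
      lemma = ℕsolve-∀

  2[nC2]+n≡n*n : ∀ n → 2 * (n C 2) + n ≡ n * n
  2[nC2]+n≡n*n zero    = refl
  2[nC2]+n≡n*n (suc n) = begin
    2 * (suc n C 2) + suc n             ≡⟨ cong (λ m → 2 * m + suc n) (sym (nCk+nC[k+1]≡[n+1]C[k+1] n 1)) ⟩
    2 * (n C 1 + n C 2) + suc n         ≡⟨ cong (λ m → 2 * (m + n C 2) + suc n) (nC1≡n n) ⟩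
    2 * (n + n C 2) + suc n             ≡⟨ lemma n (n C 2) ⟩
    2 * n + 1 + (2 * (n C 2) + n)       ≡⟨ cong (λ m → 2 * n + 1 + m) (2[nC2]+n≡n*n n) ⟩
    2 * n + 1 + n * n                   ≡⟨ lemma′ n ⟩
    suc n * suc n                       ∎
    where
      open ≡-Reasoning
      lemma : ∀ n c → 2 * (n + c) + suc n ≡ 2 * n + 1 + (2 * c + n)
      lemma = ℕsolve-∀
      lemma′ : ∀ n → 2 * n + 1 + n * n ≡ suc n * suc n
      lemma′ = ℕsolve-∀

  growth : ∀ q w t → suc q * (w ∸ t) ≤ w C 2 → 2 * q * w + w ≤ 2 * q * t + w * w
  growth q w t few-collisions = begin
    2 * q * w + w                         ≤⟨ ℕP.+-monoˡ-≤ w (ℕP.*-monoʳ-≤ (2 * q) (ℕP.m≤n+m∸n w t)) ⟩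
    2 * q * (t + (w ∸ t)) + w             ≡⟨ lemma q t (w ∸ t) w ⟩
    2 * q * t + (2 * (q * (w ∸ t)) + w)   ≤⟨ ℕP.+-monoʳ-≤ (2 * q * t) (ℕP.+-monoˡ-≤ w (ℕP.*-monoʳ-≤ 2 q[w∸t]≤wC2)) ⟩
    2 * q * t + (2 * (w C 2) + w)         ≡⟨ cong (λ m → 2 * q * t + m) (2[nC2]+n≡n*n w) ⟩
    2 * q * t + w * w                     ∎
    where
      open ℕP.≤-Reasoning
      lemma : ∀ q t e w → 2 * q * (t + e) + w ≡ 2 * q * t + (2 * (q * e) + w)
      lemma = ℕsolve-∀
      q[w∸t]≤wC2 : q * (w ∸ t) ≤ w C 2
      q[w∸t]≤wC2 = ℕP.≤-trans (ℕP.m≤n+m (q * (w ∸ t)) (w ∸ t)) few-collisions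

  ceiling : ∀ n d → 1 ≤ d → ∃[ w ] n ≤ d * w × d * w < n + d
  ceiling zero    d 1≤d = 0 , z≤n , subst (_< d) (sym (ℕP.*-zeroʳ d)) 1≤d
  ceiling (suc n) d 1≤d with ceiling n d 1≤d
  ... | w , n≤dw , dw<n+d with suc n ℕP.≤? d * w
  ...   | yes 1+n≤dw = w , 1+n≤dw , ℕP.<-≤-trans dw<n+d (ℕP.n≤1+n _)
  ...   | no 1+n≰dw  = suc w , subst (suc n ≤_) (sym d[1+w]≡d+n) (ℕP.+-monoˡ-≤ n 1≤d) ,
                       subst (_< suc n + d) (sym d[1+w]≡d+n) (s≤s (ℕP.≤-reflexive (ℕP.+-comm d n)))
    where
      d[1+w]≡d+n : d * suc w ≡ d + n
      d[1+w]≡d+n = trans (ℕP.*-suc d w) (cong (λ m → d + m) (ℕP.≤-antisym (ℕP.≤-pred (ℕP.≰⇒> 1+n≰dw)) n≤dw))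

  -- 4qU − 5U² ≤ 2(2qw + w − w²) for U = n/d.
  QuadraticAtMost : ℕ → ℕ → ℕ → ℕ → Set
  QuadraticAtMost q n d w = 4 * q * n * d + 2 * (d * w) * (d * w) ≤ 5 * n * n + 2 * (d * d) * (2 * q * w + w)

  quadraticAtMost⇒bound : ∀ q n d w t → QuadraticAtMost q n d w → suc q * (w ∸ t) ≤ w C 2 →
                          4 * q * n * d ≤ 5 * n * n + 4 * q * (d * d) * t
  quadraticAtMost⇒bound q n d w t atMost few-collisions = ℕP.+-cancelʳ-≤ (2 * (d * w) * (d * w)) _ _ (begin
    4 * q * n * d + 2 * (d * w) * (d * w)              ≤⟨ atMost ⟩
    5 * n * n + 2 * (d * d) * (2 * q * w + w)          ≤⟨ ℕP.+-monoʳ-≤ (5 * n * n)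
                                                            (ℕP.*-monoʳ-≤ (2 * (d * d)) (growth q w t few-collisions)) ⟩
    5 * n * n + 2 * (d * d) * (2 * q * t + w * w)      ≡⟨ lemma q n d w t ⟩
    5 * n * n + 4 * q * (d * d) * t + 2 * (d * w) * (d * w) ∎)
    where
      open ℕP.≤-Reasoning
      lemma : ∀ q n d w t → 5 * n * n + 2 * (d * d) * (2 * q * t + w * w) ≡ 5 * n * n + 4 * q * (d * d) * t + 2 * (d * w) * (d * w)
      lemma = ℕsolve-∀

  ceiling-estimate : ∀ n d Q W → n ≤ Q → n ≤ W → W < n + d →
                     4 * n * Q + 2 * W * W ≤ 5 * n * n + 4 * Q * W + 2 * d * W
  ceiling-estimate n d Q W n≤Q n≤W W<n+d
    with e , refl ← ℕP.m≤n⇒∃[o]m+o≡n n≤Q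
       | m , refl ← ℕP.m≤n⇒∃[o]m+o≡n n≤W
    with f , refl ← ℕP.m≤n⇒∃[o]m+o≡n (ℕP.<⇒≤ (ℕP.+-cancelˡ-< n m d W<n+d))
    = subst (4 * n * (n + e) + 2 * (n + m) * (n + m) ≤_) (sym (lemma n m e f)) (ℕP.m≤m+n _ _)
    where
      lemma : ∀ n m e f → 5 * n * n + 4 * (n + e) * (n + m) + 2 * (m + f) * (n + m)
                        ≡ 4 * n * (n + e) + 2 * (n + m) * (n + m) + (3 * n * n + 4 * e * m + 2 * m * n + 2 * f * n + 2 * f * m)
      lemma = ℕsolve-∀

  quadraticAtMost-ceiling : ∀ q n d w → n ≤ q * d → n ≤ d * w → d * w < n + d → QuadraticAtMost q n d w
  quadraticAtMost-ceiling q n d w n≤qd n≤dw dw<n+d =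
    subst₂ _≤_ (lemma q n d w) (lemma′ q n d w) (ceiling-estimate n d (q * d) (d * w) n≤qd n≤dw dw<n+d)
    where
      lemma : ∀ q n d w → 4 * n * (q * d) + 2 * (d * w) * (d * w) ≡ 4 * q * n * d + 2 * (d * w) * (d * w)
      lemma = ℕsolve-∀
      lemma′ : ∀ q n d w → 5 * n * n + 4 * (q * d) * (d * w) + 2 * d * (d * w) ≡ 5 * n * n + 2 * (d * d) * (2 * q * w + w)
      lemma′ = ℕsolve-∀

  overflow-estimate : ∀ q d V Y → 4 * q * d * Y ≤ (V + Y) * (V + Y) →
                      4 * q * (V + Y) * d + 2 * V * V ≤ 5 * (V + Y) * (V + Y) + 4 * q * d * V + 2 * d * V
  overflow-estimate q d V Y 4qdY≤[V+Y]² = begin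
    4 * q * (V + Y) * d + 2 * V * V                 ≡⟨ lemma q d V Y ⟩
    4 * q * d * V + 4 * q * d * Y + 2 * V * V       ≤⟨ ℕP.+-monoˡ-≤ (2 * V * V) (ℕP.+-monoʳ-≤ (4 * q * d * V) 4qdY≤[V+Y]²) ⟩
    4 * q * d * V + (V + Y) * (V + Y) + 2 * V * V   ≤⟨ ℕP.m≤m+n _ (2 * V * V + 8 * V * Y + 4 * Y * Y + 2 * d * V) ⟩
    4 * q * d * V + (V + Y) * (V + Y) + 2 * V * V + (2 * V * V + 8 * V * Y + 4 * Y * Y + 2 * d * V) ≡⟨ lemma′ q d V Y ⟩
    5 * (V + Y) * (V + Y) + 4 * q * d * V + 2 * d * V ∎
    where
      open ℕP.≤-Reasoning
      lemma : ∀ q d V Y → 4 * q * (V + Y) * d + 2 * V * V ≡ 4 * q * d * V + 4 * q * d * Y + 2 * V * V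
      lemma = ℕsolve-∀
      lemma′ : ∀ q d V Y → 4 * q * d * V + (V + Y) * (V + Y) + 2 * V * V + (2 * V * V + 8 * V * Y + 4 * Y * Y + 2 * d * V)
                         ≡ 5 * (V + Y) * (V + Y) + 4 * q * d * V + 2 * d * V
      lemma′ = ℕsolve-∀

  quadraticAtMost-overflow : ∀ q a s d Y → 5 ≤ a →
    4 * q * (d * (s * a) + Y) * (d * a) ≤ 5 * (d * (s * a) + Y) * (d * (s * a) + Y) + 4 * q * ((d * a) * (d * a)) * s →
    QuadraticAtMost q (d * (s * a) + Y) d (s * a)
  quadraticAtMost-overflow q a s d Y 5≤a bound-at-n/da =
    subst (4 * q * n * d + 2 * (d * (s * a)) * (d * (s * a)) ≤_) (lemma q n d (s * a))
      (overflow-estimate q d (d * (s * a)) Y 4qdY≤n²)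
    where
      n = d * (s * a) + Y
      lemma : ∀ q n d w → 5 * n * n + 4 * q * d * (d * w) + 2 * d * (d * w) ≡ 5 * n * n + 2 * (d * d) * (2 * q * w + w)
      lemma = ℕsolve-∀
      split : ∀ q a s d Y → 4 * q * (d * (s * a) + Y) * (d * a) ≡ 4 * q * ((d * a) * (d * a)) * s + 4 * q * d * Y * a
      split = ℕsolve-∀
      4qdYa≤5n² : 4 * q * d * Y * a ≤ 5 * n * n
      4qdYa≤5n² = ℕP.+-cancelˡ-≤ (4 * q * ((d * a) * (d * a)) * s) _ _
        (subst₂ _≤_ (split q a s d Y) (ℕP.+-comm (5 * n * n) _) bound-at-n/da)
      4qdY≤n² : 4 * q * d * Y ≤ (d * (s * a) + Y) * (d * (s * a) + Y)
      4qdY≤n² = ℕP.*-cancelˡ-≤ 5 (begin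
        5 * (4 * q * d * Y)  ≤⟨ ℕP.*-monoˡ-≤ (4 * q * d * Y) 5≤a ⟩
        a * (4 * q * d * Y)  ≡⟨ ℕP.*-comm a _ ⟩
        4 * q * d * Y * a    ≤⟨ 4qdYa≤5n² ⟩
        5 * n * n            ≡⟨ ℕP.*-assoc 5 n n ⟩
        5 * (n * n)          ∎)
        where open ℕP.≤-Reasoning

  quadraticBound-step : ∀ q a K s t → 5 ≤ a → QuadraticBound q K s →
                        (∀ w → w ≤ s * a → suc q * (w ∸ t) ≤ w C 2) → QuadraticBound q (a * K) t
  quadraticBound-step q a K s t 5≤a bound few-collisions n d 1≤d n≤d[aK] with n ℕP.≤? q * d
  ... | no n≰qd = begin
    4 * q * n * d                   ≡⟨ lemma q n d ⟩
    4 * n * (q * d)                 ≤⟨ ℕP.*-monoʳ-≤ (4 * n) (ℕP.<⇒≤ (ℕP.≰⇒> n≰qd)) ⟩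
    4 * n * n                       ≤⟨ ℕP.*-monoˡ-≤ n (ℕP.*-monoˡ-≤ n (ℕP.n≤1+n 4)) ⟩
    5 * n * n                       ≤⟨ ℕP.m≤m+n _ _ ⟩
    5 * n * n + 4 * q * (d * d) * t ∎
    where
      open ℕP.≤-Reasoning
      lemma : ∀ q n d → 4 * q * n * d ≡ 4 * n * (q * d)
      lemma = ℕsolve-∀
  ... | yes n≤qd with n ℕP.≤? d * (s * a) | ceiling n d 1≤d
  ...   | yes n≤d[sa] | w , n≤dw , dw<n+d =
    quadraticAtMost⇒bound q n d w t (quadraticAtMost-ceiling q n d w n≤qd n≤dw dw<n+d) (few-collisions w w≤sa)
    where
      dw<d[1+sa] : d * w < d * suc (s * a)
      dw<d[1+sa] = ℕP.<-≤-trans dw<n+d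
        (subst (n + d ≤_) (trans (ℕP.+-comm (d * (s * a)) d) (sym (ℕP.*-suc d (s * a)))) (ℕP.+-monoˡ-≤ d n≤d[sa]))
      w≤sa : w ≤ s * a
      w≤sa = ℕP.≤-pred (ℕP.*-cancelˡ-< d w (suc (s * a)) dw<d[1+sa])
  ...   | no n≰d[sa] | _ with Y , refl ← ℕP.m≤n⇒∃[o]m+o≡n (ℕP.<⇒≤ (ℕP.≰⇒> n≰d[sa])) =
    quadraticAtMost⇒bound q _ d (s * a) t
      (quadraticAtMost-overflow q a s d Y 5≤a (bound _ (d * a) 1≤da (subst (d * (s * a) + Y ≤_) (sym (ℕP.*-assoc d a K)) n≤d[aK])))
      (few-collisions (s * a) ℕP.≤-refl)
    where
      1≤da : 1 ≤ d * a
      1≤da = ℕP.*-mono-≤ 1≤d (ℕP.≤-trans (s≤s z≤n) 5≤a)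

module Rationals where

  open import Data.Integer using (_+_; _-_; _*_; -_; -[1+_])
  open import Data.Rational as ℚ using (ℚ; mkℚ; _/_; 0ℚ; toℚᵘ)
  import Data.Rational.Properties as ℚP
  open import Data.Rational.Unnormalised as ℚᵘ using (ℚᵘ; mkℚᵘ; *≤*; _≃_)
  import Data.Rational.Unnormalised.Properties as ℚᵘP
  import Data.Nat.Coprimality as Coprimality
  open QuadraticBounds using (QuadraticBound)

  fromℕ : ℕ → ℚ
  fromℕ m = mkℚ (+ m) 0 (Coprimality.sym (Coprimality.1-coprimeTo m))

  [m/1]≡fromℕ : ∀ m → + m / 1 ≡ fromℕ m
  [m/1]≡fromℕ m = ℚP.fromℚᵘ-toℚᵘ (fromℕ m)

  toℚᵘ-cubic : ∀ a b c → toℚᵘ (a ℚ.* b ℚ.* c) ≃ toℚᵘ a ℚᵘ.* toℚᵘ b ℚᵘ.* toℚᵘ c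
  toℚᵘ-cubic a b c = ℚᵘP.≃-trans (ℚP.toℚᵘ-homo-* (a ℚ.* b) c) (ℚᵘP.*-congʳ (ℚP.toℚᵘ-homo-* a b))

  toℚᵘ-quadratic : ∀ a b c U → toℚᵘ (a ℚ.* b ℚ.* U ℚ.- c ℚ.* U ℚ.* U) ≃
                   toℚᵘ a ℚᵘ.* toℚᵘ b ℚᵘ.* toℚᵘ U ℚᵘ.- toℚᵘ c ℚᵘ.* toℚᵘ U ℚᵘ.* toℚᵘ U
  toℚᵘ-quadratic a b c U = ℚᵘP.≃-trans (ℚP.toℚᵘ-homo-+ (a ℚ.* b ℚ.* U) (ℚ.- (c ℚ.* U ℚ.* U)))
    (ℚᵘP.+-cong (toℚᵘ-cubic a b U) (ℚᵘP.≃-trans (ℚP.toℚᵘ-homo‿- (c ℚ.* U ℚ.* U)) (ℚᵘP.-‿cong (toℚᵘ-cubic c U U))))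

  quadraticBound-ℤ : ∀ q n d s → 4 ℕ.* q ℕ.* n ℕ.* d ℕ.≤ 5 ℕ.* n ℕ.* n ℕ.+ 4 ℕ.* q ℕ.* (d ℕ.* d) ℕ.* s →
                     + d * (+ 4 * + q * + n * + d - + 5 * + n * + n) ℤ.≤ + d * (+ 4 * + q * (+ d * + d) * + s)
  quadraticBound-ℤ q n d s bound = ℤP.*-monoˡ-≤-nonNeg (+ d)
    (subst (_ ℤ.≤_) (lemma (+ 5 * + n * + n) _) (ℤP.+-monoˡ-≤ (- (+ 5 * + n * + n)) (subst₂ ℤ._≤_ castˡ castʳ (ℤ.+≤+ bound))))
    where
      lemma : ∀ b c → b + c - b ≡ c
      lemma = solve-∀
      castˡ : + (4 ℕ.* q ℕ.* n ℕ.* d) ≡ + 4 * + q * + n * + d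
      castˡ = trans (ℤP.pos-* (4 ℕ.* q ℕ.* n) d) (cong (λ m → m * + d)
                (trans (ℤP.pos-* (4 ℕ.* q) n) (cong (λ m → m * + n) (ℤP.pos-* 4 q))))
      castʳ : + (5 ℕ.* n ℕ.* n ℕ.+ 4 ℕ.* q ℕ.* (d ℕ.* d) ℕ.* s) ≡ + 5 * + n * + n + + 4 * + q * (+ d * + d) * + s
      castʳ = trans (ℤP.pos-+ (5 ℕ.* n ℕ.* n) (4 ℕ.* q ℕ.* (d ℕ.* d) ℕ.* s)) (cong₂ _+_
                (trans (ℤP.pos-* (5 ℕ.* n) n) (cong (λ m → m * + n) (ℤP.pos-* 5 n)))
                (trans (ℤP.pos-* (4 ℕ.* q ℕ.* (d ℕ.* d)) s) (cong (λ m → m * + s)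
                  (trans (ℤP.pos-* (4 ℕ.* q) (d ℕ.* d)) (cong₂ _*_ (ℤP.pos-* 4 q) (ℤP.pos-* d d))))))

  -- The cross products compared by *≤* reduce definitionally to the right-hand sides of lemma and lemma′.
  quadraticBound-ℚᵘ : ∀ q s n dm → 4 ℕ.* q ℕ.* n ℕ.* suc dm ℕ.≤ 5 ℕ.* n ℕ.* n ℕ.+ 4 ℕ.* q ℕ.* (suc dm ℕ.* suc dm) ℕ.* s →
    mkℚᵘ (+ 4) 0 ℚᵘ.* mkℚᵘ (+ q) 0 ℚᵘ.* mkℚᵘ (+ n) dm ℚᵘ.- mkℚᵘ (+ 5) 0 ℚᵘ.* mkℚᵘ (+ n) dm ℚᵘ.* mkℚᵘ (+ n) dm
      ℚᵘ.≤ mkℚᵘ (+ 4) 0 ℚᵘ.* mkℚᵘ (+ q) 0 ℚᵘ.* mkℚᵘ (+ s) 0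
  quadraticBound-ℚᵘ q s n dm bound =
    *≤* (subst₂ ℤ._≤_ (lemma (+ q) (+ n) D) (lemma′ (+ q) (+ s) D) (quadraticBound-ℤ q n (suc dm) s bound))
    where
      D : ℤ
      D = + suc dm
      lemma : ∀ q n D → D * (+ 4 * q * n * D - + 5 * n * n) ≡
              ((+ 4 * q * n) * (+ 1 * D * D) + - (+ 5 * n * n) * (+ 1 * + 1 * D)) * (+ 1 * + 1 * + 1)
      lemma = solve-∀
      lemma′ : ∀ q s D → D * (+ 4 * q * (D * D) * s) ≡ (+ 4 * q * s) * ((+ 1 * + 1 * D) * (+ 1 * D * D))
      lemma′ = solve-∀

  quadraticBound⇒ℚ : ∀ q K s → QuadraticBound q K s → (U : ℚ) → 0ℚ ℚ.≤ U → U ℚ.≤ + K / 1 →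
    (+ 4 / 1) ℚ.* (+ q / 1) ℚ.* U ℚ.- (+ 5 / 1) ℚ.* U ℚ.* U ℚ.≤ (+ 4 / 1) ℚ.* (+ q / 1) ℚ.* (+ s / 1)
  quadraticBound⇒ℚ q K s bound (mkℚ -[1+ _ ] _ _) (ℚ.*≤* ()) _
  quadraticBound⇒ℚ q K s bound U@(mkℚ (+ n) dm _) _ U≤K rewrite [m/1]≡fromℕ q | [m/1]≡fromℕ s =
    ℚP.toℚᵘ-cancel-≤ (ℚᵘP.≤-respˡ-≃ (ℚᵘP.≃-sym (toℚᵘ-quadratic (+ 4 / 1) (fromℕ q) (+ 5 / 1) U))
      (ℚᵘP.≤-respʳ-≃ (ℚᵘP.≃-sym (toℚᵘ-cubic (+ 4 / 1) (fromℕ q) (fromℕ s)))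
        (quadraticBound-ℚᵘ q s n dm (bound n (suc dm) (s≤s z≤n) n≤dK))))
    where
      n≤dK : n ℕ.≤ suc dm ℕ.* K
      n≤dK = subst₂ ℕ._≤_ (ℕP.*-identityʳ n) (ℕP.*-comm K (suc dm))
        (ℤP.drop‿+≤+ (subst₂ ℤ._≤_ (sym (ℤP.pos-* n 1)) (sym (ℤP.pos-* K (suc dm)))
          (ℚP.drop-*≤* (subst (U ℚ.≤_) ([m/1]≡fromℕ K) U≤K))))

module Aₖ-Growth (q : ℕ) (prime : Prime (suc q)) (A : Subset (suc q)) (5≤∣A∣ : 5 ℕ.≤ ∣ A ∣) where

  open Residues (suc q)
  open Field prime
  open Directions (suc q)
  open Closure (suc q)
  open QuadraticBounds

  2≤∣A∣ : 2 ℕ.≤ ∣ A ∣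
  2≤∣A∣ = ℕP.≤-trans (s≤s (s≤s z≤n)) 5≤∣A∣

  nonzero-element : ∃[ a ] a ∈ A × ⟦ a ⟧ ≉ + 0
  nonzero-element with two-distinct A 2≤∣A∣
  ... | y₁ , y₂ , y₁∈A , y₂∈A , y₁≢y₂ with y₁ Fin.≟ 0 mod suc q
  ...   | yes refl = y₂ , y₂∈A , ≢0⇒≉0 (λ y₂≡0 → y₁≢y₂ (sym y₂≡0))
  ...   | no y₁≢0  = y₁ , y₁∈A , ≢0⇒≉0 y₁≢0

  -- power a j = a^(j+1), matching the indexing of prodPow.
  power : Fin (suc q) → ℕ → Fin (suc q)
  power a zero    = a
  power a (suc j) = power a j *ₚ a

  power∈prodPow : ∀ {a} → a ∈ A → ∀ j → power a j ∈ prodPow A j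
  power∈prodPow a∈A zero    = a∈A
  power∈prodPow a∈A (suc j) = ∈-image₂⁺ _*ₚ_ (power∈prodPow a∈A j) a∈A

  power≉0 : ∀ {a} → ⟦ a ⟧ ≉ + 0 → ∀ j → ⟦ power a j ⟧ ≉ + 0
  power≉0 a≉0 zero    = a≉0
  power≉0 {a} a≉0 (suc j) aʲa≈0 = *-≉0 (power≉0 a≉0 j) a≉0 (≈-trans (≈-sym (⟦*ₚ⟧ (power a j) a)) aʲa≈0)

  collision-growth : ∀ k w → w ℕ.≤ ∣ Aₖ A (suc k) ∣ ℕ.* ∣ A ∣ → suc q ℕ.* (w ∸ ∣ Aₖ A (2 ℕ.+ k) ∣) ℕ.≤ w C 2
  collision-growth k w w≤ with two-distinct A 2≤∣A∣ | nonzero-element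
  collision-growth zero w w≤ | y₁ , y₂ , y₁∈A , y₂∈A , y₁≢y₂ | _ =
    combinations-bound prime (λ 1ₚ≈0 → 1≉0 (≈-trans (≈-sym (⟦mod⟧ 1)) 1ₚ≈0)) (combinations-A₂ A (⟦mod⟧ 1))
      y₁∈A y₁∈A y₂∈A y₁≢y₂ w≤
  collision-growth (suc j) w w≤ | y₁ , y₂ , y₁∈A , y₂∈A , y₁≢y₂ | a , a∈A , a≉0 =
    combinations-bound prime (power≉0 a≉0 j) (combinations-Aₖ A j (power∈prodPow a∈A j))
      (zero∈Aₖ j (power∈prodPow a∈A (suc j))) y₁∈A y₂∈A y₁≢y₂ w≤

  Aₖ-quadraticBound : ∀ k → QuadraticBound q (∣ A ∣ ^ suc k) ∣ Aₖ A (suc k) ∣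
  Aₖ-quadraticBound zero    = quadraticBound-base q (ℕP.≤-reflexive (ℕP.*-identityʳ ∣ A ∣))
  Aₖ-quadraticBound (suc k) =
    quadraticBound-step q ∣ A ∣ (∣ A ∣ ^ suc k) _ _ 5≤∣A∣ (Aₖ-quadraticBound k) (collision-growth k)

open import Data.Integer using (+_)
open import Data.Rational using (ℚ; _/_; _*_; _-_; _≤_; 0ℚ)

lemma8 : (p : ℕ) .{{_ : NonZero p}} → Prime p → 2 ℕ.< p →
         (A : Subset p) → 5 ℕ.≤ ∣ A ∣ →
         (k : ℕ) → 1 ℕ.≤ k →
         (U : ℚ) → 0ℚ ≤ U → U ≤ (+ (∣ A ∣ ^ k) / 1) →
         (+ 4 / 1) * (+ (p ∸ 1) / 1) * U - (+ 5 / 1) * U * U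
           ≤ (+ 4 / 1) * (+ (p ∸ 1) / 1) * (+ ∣ Aₖ A k ∣ / 1)
lemma8 (suc q) isPrime _ A 5≤∣A∣ (suc k) _ =
  Rationals.quadraticBound⇒ℚ q (∣ A ∣ ^ suc k) ∣ Aₖ A (suc k) ∣ (Aₖ-Growth.Aₖ-quadraticBound q isPrime A 5≤∣A∣ k)
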